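{- For every $(i_1,\dots,i_k)\in\mathbb{Z}_{\ge0}^k$, the set $\{r_{\lambda^k}: |\lambda^k|=(i_1,\dots,i_k)\}$ is a basis of the vector space $\Lambda_k^{(i_1,\dots,i_k)}$.
   Context: Fix $k\ge1$. For $i\ge1$, $1\le j\le k$ let $(x_i)_j$ be commuting indeterminates, and for $\alpha\in\mathbb{Z}_{\ge0}^k$ let $x_i^\alpha=\prod_j((x_i)_j)^{\alpha_j}$. $\Lambda_k$ is the $\mathbb{C}$-vector space of formal power series in all $(x_i)_j$ of bounded total degree that are invariant under replacing every $(x_i)_j$ by $(x_{\sigma(i)})_j$ (simultaneously for all $j$) for every permutation $\sigma$ of the positive integers. $\Lambda_k^{(i_1,\dots,i_k)}$ is the subspace of elements all of whose monomials have degree exactly $i_j$ in the variables $(x_1)_j,(x_2)_j,\dots$ for each $j$. A $k$-tuple partition is a finite multiset $\lambda^k=\{\lambda^k_1,\dots,\lambda^k_l\}$ of elements of $\mathbb{Z}_{\ge0}^k\setminus\{0^k\}$, and $|\lambda^k|=\sum_t\lambda^k_t\in\mathbb{Z}_{\ge0}^k$ (componentwise). Let $\epsilon_i\in\mathbb{Z}_{\ge0}^k$ have $1$ in coordinate $i$ and $0$ elsewhere. For a finite graph $G$ with weights $w:V(G)\to\mathbb{Z}_{\ge0}^k\setminus\{0^k\}$, $X_{(G,w,k)}=\sum_{\kappa}\prod_{v}x_{\kappa(v)}^{w(v)}$, summed over proper colorings $\kappa:V(G)\to\mathbb{Z}_{>0}$ (adjacent vertices get different colors). For a $k$-tuple partition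 $\lambda^k=\{\lambda_1^k,\dots,\lambda_l^k\}$, let $I^{\lambda^k}$ be the graph whose vertex set is a disjoint union $U_1\sqcup\dots\sqcup U_l$, where $U_t$ consists of, for each $i$, exactly $(\lambda^k_t)_i$ vertices of weight $\epsilon_i$, with an edge between every two vertices lying in different $U_t$'s and no other edges (the complete multipartite graph with parts $U_1,\dots,U_l$). Define $r_{\lambda^k}=X_{(I^{\lambda^k},w,k)}$. -}

module Defs where

open import Level using (Level; _⊔_) renaming (suc to lsuc)
open import Data.Nat using (ℕ; zero; suc; _+_; _≟_)
open import Data.Fin using (Fin; zero; suc; toℕ)
import Data.Fin as Fin
open import Data.Fin.Properties using (all?)
open import Data.Vec using (Vec; []; _∷_; lookup; tabulate; replicate; zipWith; foldr)
import Data.Vec.Properties as VecP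
open import Data.List using (List; []; _∷_; [_]; length; map; concatMap; filter; concat; replicate)
  renaming (foldr to lfoldr)
open import Data.List.Relation.Unary.All using (All)
open import Data.Product using (Σ; _×_; _,_; proj₁; proj₂; ∃)
open import Data.Bool using (if_then_else_)
open import Relation.Nullary using (¬_; Dec; yes; no)
open import Relation.Nullary.Decidable using (_×-dec_; _→-dec_; ¬?; ⌊_⌋)
open import Relation.Binary.PropositionalEquality using (_≡_; _≢_; refl; cong)
open import Function.Bundles using (_↔_; Inverse)
open import Algebra.Bundles using (CommutativeRing)

ringOfℕ : ∀ {c ℓ} (R : CommutativeRing c ℓ) → ℕ → CommutativeRing.Carrier R
ringOfℕ R zero    = CommutativeRing.0# R
ringOfℕ R (suc n) = CommutativeRing._+_ R (CommutativeRing.1# R) (ringOfℕ R n)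

record Char0Field (c ℓ : Level) : Set (lsuc (c ⊔ ℓ)) where
  field
    commRing : CommutativeRing c ℓ
  field
    inverse : ∀ x → ¬ (CommutativeRing._≈_ commRing x (CommutativeRing.0# commRing)) →
              Σ (CommutativeRing.Carrier commRing)
                (λ y → CommutativeRing._≈_ commRing (CommutativeRing._*_ commRing x y)
                                                    (CommutativeRing.1# commRing))
    char0   : ∀ n → ¬ (CommutativeRing._≈_ commRing (ringOfℕ commRing (suc n))
                                                    (CommutativeRing.0# commRing))
  open CommutativeRing commRing public
  ofℕ : ℕ → Carrier
  ofℕ = ringOfℕ commRing

-- The variable (x_i)_j (i ≥ 1, 1 ≤ j ≤ k) is indexed here by
-- i-1 : ℕ and j-1 : Fin k.  A monomial ∏_i x_i^{a_i} is represented by a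
-- finite list (Vec of length n) of exponent vectors a_0, …, a_{n-1}
-- (exponents of x_1,…,x_n); all later exponents are 0.

0ᵏ : ∀ {k} → Vec ℕ k
0ᵏ {k} = Data.Vec.replicate k 0

_+ᵛ_ : ∀ {k} → Vec ℕ k → Vec ℕ k → Vec ℕ k
_+ᵛ_ = zipWith _+_

ε : ∀ {k} → Fin k → Vec ℕ k
ε j = tabulate (λ j′ → if ⌊ j Fin.≟ j′ ⌋ then 1 else 0)

multideg : ∀ {k n} → Vec (Vec ℕ k) n → Vec ℕ k
multideg = foldr _ _+ᵛ_ 0ᵏ

-- the exponent of x_{i+1} in the monomial represented by m
ext : ∀ {k n} → Vec (Vec ℕ k) n → ℕ → Vec ℕ k
ext []      i       = 0ᵏ
ext (a ∷ m) zero    = a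
ext (a ∷ m) (suc i) = ext m i

module _ {c ℓ} (F : Char0Field c ℓ) (k : ℕ) where
  open Char0Field F

  -- coefficient of the monomial represented by m
  Series : Set c
  Series = (n : ℕ) → Vec (Vec ℕ k) n → Carrier

  -- invariance under every permutation σ of the variable indices
  -- (this includes σ = id: independence of the chosen representation)
  IsSymmetric : Series → Set ℓ
  IsSymmetric f = ∀ (σ : ℕ ↔ ℕ) (n : ℕ) (m : Vec (Vec ℕ k) n)
                    (n′ : ℕ) (m′ : Vec (Vec ℕ k) n′) →
                  (∀ i → ext m′ i ≡ ext m (Inverse.to σ i)) →
                  f n′ m′ ≈ f n m

  HasMultidegree : Vec ℕ k → Series → Set ℓ
  HasMultidegree d f = ∀ (n : ℕ) (m : Vec (Vec ℕ k) n) → multideg m ≢ d → f n m ≈ 0#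

  InΛ : Vec ℕ k → Series → Set ℓ
  InΛ d f = IsSymmetric f × HasMultidegree d f

record WGraph (k : ℕ) : Set₁ where
  field
    nV      : ℕ
    Adj     : Fin nV → Fin nV → Set
    adj?    : ∀ u v → Dec (Adj u v)
    adj-sym : ∀ {u v} → Adj u v → Adj v u
    adj-irr : ∀ {u} → ¬ Adj u u
    wt      : Fin nV → Vec ℕ k
    wt-nz   : ∀ v → wt v ≢ 0ᵏ

allMaps : (n l : ℕ) → List (Vec (Fin n) l)
allMaps n zero    = [ [] ]
allMaps n (suc l) = concatMap (λ c → map (c ∷_) (allMaps n l)) (Data.List.allFin n)

module _ {k : ℕ} (G : WGraph k) where
  open WGraph G

  Proper : ∀ {n} → Vec (Fin n) nV → Set
  Proper κ = ∀ u v → Adj u v → lookup κ u ≢ lookup κ v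

  proper? : ∀ {n} (κ : Vec (Fin n) nV) → Dec (Proper κ)
  proper? κ = all? (λ u → all? (λ v → adj? u v →-dec ¬? (lookup κ u Fin.≟ lookup κ v)))

  colourWeight : ∀ {n} → Vec (Fin n) nV → Fin n → Vec ℕ k
  colourWeight κ col =
    lfoldr (λ v acc → (if ⌊ lookup κ v Fin.≟ col ⌋ then wt v else 0ᵏ) +ᵛ acc)
           0ᵏ (Data.List.allFin nV)

  Produces : ∀ {n} → Vec (Vec ℕ k) n → Vec (Fin n) nV → Set
  Produces m κ = ∀ col → colourWeight κ col ≡ lookup m col

  produces? : ∀ {n} (m : Vec (Vec ℕ k) n) (κ : Vec (Fin n) nV) → Dec (Produces m κ)
  produces? m κ = all? (λ col → VecP.≡-dec _≟_ (colourWeight κ col) (lookup m col))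

  -- number of proper colourings κ with ∏_v x_{κ(v)}^{w(v)} = x^m.
  -- Since all weights are nonzero, such κ only use colours < n.
  coeffX : ∀ {n} → Vec (Vec ℕ k) n → ℕ
  coeffX {n} m = length (filter (λ κ → proper? κ ×-dec produces? m κ) (allMaps n nV))

X : ∀ {c ℓ} (F : Char0Field c ℓ) {k} → WGraph k → Series F k
X F G n m = Char0Field.ofℕ F (coeffX G m)

-- k-tuple partitions: finite multisets of nonzero vectors, represented
-- as lists (multiset equality = permutation _↭_ of lists).

KPart : ℕ → Set
KPart k = Σ (List (Vec ℕ k)) (All (λ v → v ≢ 0ᵏ))

∣_∣ : ∀ {k} → KPart k → Vec ℕ k
∣ λk , _ ∣ = lfoldr _+ᵛ_ 0ᵏ λk

ε-nz : ∀ {k} (j : Fin k) → ε j ≢ 0ᵏ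
ε-nz {k} j eq with cong (λ v → lookup v j) eq
... | e rewrite VecP.lookup∘tabulate (λ j′ → if ⌊ j Fin.≟ j′ ⌋ then 1 else 0) j
              | VecP.lookup-replicate j 0 with j Fin.≟ j
...   | yes _ = helper e
  where helper : 1 ≢ 0
        helper ()
...   | no ne = ne refl

-- vertices of I^λ: (part index t, coordinate i), with (λ_t)_i copies of (t, i)
partVerts : ∀ {k} → ℕ → Vec ℕ k → List (ℕ × Fin k)
partVerts t a = concatMap (λ i → Data.List.replicate (lookup a i) (t , i)) (Data.List.allFin _)

vertsFrom : ∀ {k} → ℕ → List (Vec ℕ k) → List (ℕ × Fin k)
vertsFrom t []      = []
vertsFrom t (a ∷ λk) = partVerts t a Data.List.++ vertsFrom (suc t) λk

I : ∀ {k} → KPart k → WGraph k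
I {k} (λk , _) = record
  { nV      = length vs
  ; Adj     = λ u v → part u ≢ part v
  ; adj?    = λ u v → ¬? (part u Data.Nat.≟ part v)
  ; adj-sym = λ ne eq → ne (Relation.Binary.PropositionalEquality.sym eq)
  ; adj-irr = λ ne → ne refl
  ; wt      = λ v → ε (proj₂ (Data.List.lookup vs v))
  ; wt-nz   = λ v → ε-nz (proj₂ (Data.List.lookup vs v))
  }
  where
  vs = vertsFrom 0 λk
  part : Fin (length vs) → ℕ
  part v = proj₁ (Data.List.lookup vs v)

r : ∀ {c ℓ} (F : Char0Field c ℓ) {k} → KPart k → Series F k
r F λk = X F (I λk)

linComb : ∀ {c ℓ} (F : Char0Field c ℓ) {k} →
          List (Char0Field.Carrier F × KPart k) → Series F k
linComb F cs n m =
  lfoldr (λ p acc → (proj₁ p * r F (proj₂ p) n m) ⊕ acc) 0# cs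
  where open Char0Field F using (_*_; 0#) renaming (_+_ to _⊕_)

-- The coefficient of x^μ in r_λ counts the proper colourings of the complete multipartite graph I^λ
-- in which colour c carries total weight μ_c. Vertices in different parts of λ are adjacent, so such
-- a colouring needs ℓ(λ) ≤ ℓ(μ), and when ℓ(λ) = ℓ(μ) every colour class is a single part, forcing
-- λ = μ; colouring the t-th part with colour t shows that the diagonal coefficient is positive. Over
-- a field of characteristic 0 the matrix of the r_λ against the monomials x^μ is thus triangular with
-- invertible diagonal when partitions are ordered by length. This gives linear independence, and
-- spanning follows by solving the triangular system for the values of a symmetric f at the x^μ.
-- Symmetry of r_λ holds because renaming the variables merely renames the colours.

module Submission where

open import Defs
open import Data.Nat using (ℕ)
open import Data.Vec using (Vec)
open import Data.List using (List)
open import Data.List.Relation.Unary.All using (All)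
open import Data.List.Relation.Unary.AllPairs using (AllPairs)
open import Data.List.Relation.Binary.Permutation.Propositional using (_↭_)
open import Data.Product using (Σ; _×_; proj₁; proj₂)
open import Relation.Nullary using (¬_)
open import Relation.Binary.PropositionalEquality using (_≡_)

open import Data.Nat using (zero; suc; _+_; _*_; _≤_; _<_; z≤n; s≤s; _≟_; _<?_; s≤s⁻¹)
import Data.Nat.Properties as ℕP
open import Data.Fin as Fin using (Fin; zero; suc; toℕ; fromℕ<)
import Data.Fin.Properties as FinP
open import Data.Vec as Vec using ([]; _∷_; lookup)
import Data.Vec.Properties as VecP
open import Data.List as List using ([]; _∷_; length; _++_; map; concatMap; filter; allFin)
import Data.List.Properties as ListP
open import Data.List.Membership.Propositional using (_∈_; find; lose)
import Data.List.Membership.Propositional.Properties as ∈P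
open import Data.List.Relation.Unary.Any using (here; there)
import Data.List.Relation.Unary.All as All
open import Data.List.Relation.Unary.All using ([]; _∷_)
import Data.List.Relation.Unary.All.Properties as AllP
import Data.List.Relation.Unary.AllPairs as AllPairs
import Data.List.Relation.Unary.AllPairs.Properties as AllPairsP
open import Data.List.Relation.Unary.Unique.Propositional using (Unique)
open import Data.List.Relation.Binary.Disjoint.Propositional using (Disjoint)
import Data.List.Relation.Unary.Unique.Propositional.Properties as UniqueP
open import Data.List.Relation.Binary.Permutation.Propositional
  using (↭-refl; ↭-prep; ↭-swap; ↭-trans; ↭-sym)
open import Data.Product using (_,_; ∃; map₁; map₂)
open import Data.Sum using (_⊎_; inj₁; inj₂; [_,_]′) renaming (map₁ to ⊎-map₁; map₂ to ⊎-map₂)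
open import Data.Empty using (⊥-elim)
open import Data.Bool using (Bool; true; false; if_then_else_)
open import Relation.Nullary using (Dec; yes; no)
open import Relation.Nullary.Decidable using (⌊_⌋; _×-dec_; isYes≗does; does-⇔)
open import Relation.Binary.PropositionalEquality
  using (_≢_; refl; sym; trans; cong; cong₂; subst; subst₂; module ≡-Reasoning)
open import Function.Bundles using (_↔_; Inverse; mk↔ₛ′; mk⇔)
open import Function.Properties.Inverse using (↔-refl; ↔-sym; ↔-trans)

Σℕ : ∀ {a} {A : Set a} → List A → (A → ℕ) → ℕ
Σℕ xs g = List.foldr (λ x acc → g x + acc) 0 xs

Σℕ-cong : ∀ {a} {A : Set a} (xs : List A) {g h : A → ℕ} → (∀ x → g x ≡ h x) → Σℕ xs g ≡ Σℕ xs h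
Σℕ-cong []       g≡h = refl
Σℕ-cong (x ∷ xs) g≡h = cong₂ _+_ (g≡h x) (Σℕ-cong xs g≡h)

Σℕ-zero : ∀ {a} {A : Set a} (xs : List A) {g : A → ℕ} → (∀ x → g x ≡ 0) → Σℕ xs g ≡ 0
Σℕ-zero []       g≡0 = refl
Σℕ-zero (x ∷ xs) g≡0 rewrite g≡0 x = Σℕ-zero xs g≡0

Σℕ-++ : ∀ {a} {A : Set a} (xs ys : List A) (g : A → ℕ) → Σℕ (xs ++ ys) g ≡ Σℕ xs g + Σℕ ys g
Σℕ-++ []       ys g = refl
Σℕ-++ (x ∷ xs) ys g = trans (cong (g x +_) (Σℕ-++ xs ys g)) (sym (ℕP.+-assoc (g x) _ _))

Σℕ-concatMap : ∀ {a b} {A : Set a} {B : Set b} (f : A → List B) (xs : List A) (g : B → ℕ) →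
  Σℕ (concatMap f xs) g ≡ Σℕ xs (λ x → Σℕ (f x) g)
Σℕ-concatMap f []       g = refl
Σℕ-concatMap f (x ∷ xs) g =
  trans (Σℕ-++ (f x) (concatMap f xs) g) (cong (Σℕ (f x) g +_) (Σℕ-concatMap f xs g))

Σℕ-replicate : ∀ {a} {A : Set a} r (x : A) (g : A → ℕ) → Σℕ (List.replicate r x) g ≡ r * g x
Σℕ-replicate zero    x g = refl
Σℕ-replicate (suc r) x g = cong (g x +_) (Σℕ-replicate r x g)

Σℕ-+ : ∀ {a} {A : Set a} (xs : List A) (g h : A → ℕ) → Σℕ xs (λ x → g x + h x) ≡ Σℕ xs g + Σℕ xs h
Σℕ-+ []       g h = refl
Σℕ-+ (x ∷ xs) g h = trans (cong (g x + h x +_) (Σℕ-+ xs g h)) (+-interchange (g x) (h x) _ _)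
  where open import Algebra.Properties.CommutativeSemigroup ℕP.+-commutativeSemigroup
          using () renaming (interchange to +-interchange)

Σℕ-comm : ∀ {a b} {A : Set a} {B : Set b} (xs : List A) (ys : List B) (g : A → B → ℕ) →
  Σℕ xs (λ x → Σℕ ys (g x)) ≡ Σℕ ys (λ y → Σℕ xs (λ x → g x y))
Σℕ-comm []       ys g = sym (Σℕ-zero ys (λ _ → refl))
Σℕ-comm (x ∷ xs) ys g = trans (cong (Σℕ ys (g x) +_) (Σℕ-comm xs ys g))
  (sym (Σℕ-+ ys (g x) (λ y → Σℕ xs (λ x′ → g x′ y))))

∈⇒≤Σℕ : ∀ {a} {A : Set a} {xs : List A} (g : A → ℕ) {x} → x ∈ xs → g x ≤ Σℕ xs g
∈⇒≤Σℕ g (here refl) = ℕP.m≤m+n _ _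
∈⇒≤Σℕ {xs = y ∷ xs} g (there x∈xs) = ℕP.≤-trans (∈⇒≤Σℕ g x∈xs) (ℕP.m≤n+m _ (g y))

Σℕ≢0⇒∃ : ∀ {a} {A : Set a} (xs : List A) (g : A → ℕ) → Σℕ xs g ≢ 0 → ∃ λ x → g x ≢ 0
Σℕ≢0⇒∃ []       g Σ≢0 = ⊥-elim (Σ≢0 refl)
Σℕ≢0⇒∃ (x ∷ xs) g Σ≢0 with g x ≟ 0
... | no gx≢0 = x , gx≢0
... | yes gx≡0 = Σℕ≢0⇒∃ xs g (λ Σ≡0 → Σ≢0 (trans (cong (_+ Σℕ xs g) gx≡0) Σ≡0))

ΣFin : (n : ℕ) → (Fin n → ℕ) → ℕ
ΣFin zero    g = 0
ΣFin (suc n) g = g zero + ΣFin n (λ i → g (suc i))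

ΣFin-cong : ∀ n {g h : Fin n → ℕ} → (∀ i → g i ≡ h i) → ΣFin n g ≡ ΣFin n h
ΣFin-cong zero    g≡h = refl
ΣFin-cong (suc n) g≡h = cong₂ _+_ (g≡h zero) (ΣFin-cong n (λ i → g≡h (suc i)))

Σℕ-allFin : ∀ n (g : Fin n → ℕ) → Σℕ (allFin n) g ≡ ΣFin n g
Σℕ-allFin n g = Σℕ-tabulate n (λ i → i)
  where
  Σℕ-tabulate : ∀ m (f : Fin m → Fin n) → Σℕ (List.tabulate f) g ≡ ΣFin m (λ i → g (f i))
  Σℕ-tabulate zero    f = refl
  Σℕ-tabulate (suc m) f = cong (g (f zero) +_) (Σℕ-tabulate m (λ i → f (suc i)))

ΣFin-lookup : ∀ {a} {A : Set a} (xs : List A) (g : A → ℕ) →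
  ΣFin (length xs) (λ i → g (List.lookup xs i)) ≡ Σℕ xs g
ΣFin-lookup []       g = refl
ΣFin-lookup (x ∷ xs) g = cong (g x +_) (ΣFin-lookup xs g)

when : Bool → ℕ → ℕ
when b n = if b then n else 0

*-when : ∀ r b n → r * when b n ≡ when b (r * n)
*-when r true  n = refl
*-when r false n = ℕP.*-zeroʳ r

Σℕ-when : ∀ {a} {A : Set a} (xs : List A) b (h : A → ℕ) → Σℕ xs (λ x → when b (h x)) ≡ when b (Σℕ xs h)
Σℕ-when xs true  h = refl
Σℕ-when xs false h = Σℕ-zero xs (λ _ → refl)

isYes-⇔ : ∀ {p q} {P : Set p} {Q : Set q} → (P → Q) → (Q → P) →
  (p? : Dec P) (q? : Dec Q) → ⌊ p? ⌋ ≡ ⌊ q? ⌋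
isYes-⇔ P→Q Q→P p? q? =
  trans (isYes≗does p?) (trans (does-⇔ (mk⇔ P→Q Q→P) p? q?) (sym (isYes≗does q?)))

isYes-true : ∀ {x y} → x ≡ y → ⌊ x ≟ y ⌋ ≡ true
isYes-true {x} {y} x≡y = isYes-⇔ (λ _ → refl) (λ _ → x≡y) (x ≟ y) (0 ≟ 0)

isYes-false : ∀ {x y} → x ≢ y → ⌊ x ≟ y ⌋ ≡ false
isYes-false {x} {y} x≢y = isYes-⇔ (λ x≡y → ⊥-elim (x≢y x≡y)) (λ ()) (x ≟ y) (0 ≟ 1)

when-≢0 : ∀ x y n → when ⌊ x ≟ y ⌋ n ≢ 0 → x ≡ y
when-≢0 x y n w≢0 with x ≟ y
... | yes x≡y = x≡y
... | no  _   = ⊥-elim (w≢0 refl)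

ΣFin-indicator : ∀ n (i : Fin n) (g : Fin n → ℕ) → ΣFin n (λ c → when ⌊ toℕ i ≟ toℕ c ⌋ (g c)) ≡ g i
ΣFin-indicator (suc n) zero    g = trans (cong (g zero +_) (ΣFin-zero n)) (ℕP.+-identityʳ (g zero))
  where
  ΣFin-zero : ∀ n → ΣFin n (λ _ → 0) ≡ 0
  ΣFin-zero zero    = refl
  ΣFin-zero (suc n) = ΣFin-zero n
ΣFin-indicator (suc n) (suc i) g =
  trans (ΣFin-cong n (λ c → cong (λ b → when b (g (suc c)))
          (isYes-⇔ ℕP.suc-injective (cong suc) (suc (toℕ i) ≟ suc (toℕ c)) (toℕ i ≟ toℕ c))))
        (ΣFin-indicator n i (λ c → g (suc c)))

lookup-ext : ∀ {a} {A : Set a} {n} (u v : Vec A n) → (∀ i → lookup u i ≡ lookup v i) → u ≡ v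
lookup-ext []      []      _ = refl
lookup-ext (x ∷ u) (y ∷ v) u≗v = cong₂ _∷_ (u≗v zero) (lookup-ext u v (λ i → u≗v (suc i)))

lookup-0ᵏ : ∀ {k} (j : Fin k) → lookup (0ᵏ {k}) j ≡ 0
lookup-0ᵏ j = VecP.lookup-replicate j 0

lookup-+ᵛ : ∀ {k} (a b : Vec ℕ k) (j : Fin k) → lookup (a +ᵛ b) j ≡ lookup a j + lookup b j
lookup-+ᵛ a b j = VecP.lookup-zipWith _+_ j a b

lookup-Σᵛ : ∀ {a} {A : Set a} {k} (xs : List A) (h : A → Vec ℕ k) (j : Fin k) →
  lookup (List.foldr (λ x acc → h x +ᵛ acc) 0ᵏ xs) j ≡ Σℕ xs (λ x → lookup (h x) j)
lookup-Σᵛ []       h j = lookup-0ᵏ j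
lookup-Σᵛ (x ∷ xs) h j = trans (lookup-+ᵛ (h x) _ j) (cong (lookup (h x) j +_) (lookup-Σᵛ xs h j))

lookup-if-0ᵏ : ∀ {k} b (a : Vec ℕ k) j → lookup (if b then a else 0ᵏ) j ≡ when b (lookup a j)
lookup-if-0ᵏ true  a j = refl
lookup-if-0ᵏ false a j = lookup-0ᵏ j

lookup-ε : ∀ {k} (i j : Fin k) → lookup (ε i) j ≡ when ⌊ toℕ j ≟ toℕ i ⌋ 1
lookup-ε i j = trans (VecP.lookup∘tabulate _ j)
  (cong (λ b → when b 1) (isYes-⇔ (λ i≡j → cong toℕ (sym i≡j)) (λ e → sym (FinP.toℕ-injective e))
                                   (i Fin.≟ j) (toℕ j ≟ toℕ i)))

≢0ᵏ⇒∃ : ∀ {k} (a : Vec ℕ k) → a ≢ 0ᵏ → ∃ λ j → lookup a j ≢ 0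
≢0ᵏ⇒∃ {k} a a≢0 = FinP.¬∀⟶∃¬ k (λ j → lookup a j ≡ 0) (λ j → lookup a j ≟ 0)
  (λ a≗0 → a≢0 (lookup-ext _ _ λ j → trans (a≗0 j) (sym (lookup-0ᵏ j))))

lookup-multideg : ∀ {k n} (m : Vec (Vec ℕ k) n) j → lookup (multideg m) j ≡ ΣFin n (λ c → lookup (lookup m c) j)
lookup-multideg []      j = lookup-0ᵏ j
lookup-multideg (a ∷ m) j = trans (lookup-+ᵛ a _ j) (cong (lookup a j +_) (lookup-multideg m j))

ext-toℕ : ∀ {k n} (m : Vec (Vec ℕ k) n) (c : Fin n) → ext m (toℕ c) ≡ lookup m c
ext-toℕ (a ∷ m) zero    = refl
ext-toℕ (a ∷ m) (suc c) = ext-toℕ m c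

ext-≥ : ∀ {k n} (m : Vec (Vec ℕ k) n) (c : ℕ) → n ≤ c → ext m c ≡ 0ᵏ
ext-≥ []      c       _         = refl
ext-≥ (a ∷ m) (suc c) (s≤s n≤c) = ext-≥ m c n≤c

ext≢0ᵏ⇒< : ∀ {k n} (m : Vec (Vec ℕ k) n) (c : ℕ) → ext m c ≢ 0ᵏ → c < n
ext≢0ᵏ⇒< {n = n} m c ext≢0 with c <? n
... | yes c<n = c<n
... | no  c≮n = ⊥-elim (ext≢0 (ext-≥ m c (ℕP.≮⇒≥ c≮n)))

∈-allMaps : ∀ n l (κ : Vec (Fin n) l) → κ ∈ allMaps n l
∈-allMaps n zero    []      = here refl
∈-allMaps n (suc l) (c ∷ κ) =
  ∈P.∈-concat⁺′ (∈P.∈-map⁺ (c ∷_) (∈-allMaps n l κ)) (∈P.∈-map⁺ _ (∈P.∈-allFin c))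

allMaps-unique : ∀ n l → Unique (allMaps n l)
allMaps-unique n zero    = [] AllPairs.∷ AllPairs.[]
allMaps-unique n (suc l) =
  UniqueP.concat⁺
    (AllP.map⁺ (All.universal (λ c → UniqueP.map⁺ VecP.∷-injectiveʳ (allMaps-unique n l)) (allFin n)))
    (AllPairsP.map⁺ (AllPairs.map disjoint (UniqueP.allFin⁺ n)))
  where
  disjoint : ∀ {c c′} → c ≢ c′ → Disjoint (map (c ∷_) (allMaps n l)) (map (c′ ∷_) (allMaps n l))
  disjoint c≢c′ (p , q) with ∈P.∈-map⁻ _ p | ∈P.∈-map⁻ _ q
  ... | _ , _ , refl | _ , _ , eq = c≢c′ (VecP.∷-injectiveˡ eq)

All⇒lookup-fromList : ∀ {a p} {A : Set a} {P : A → Set p} (xs : List A) → All P xs →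
  ∀ i → P (lookup (Vec.fromList xs) i)
All⇒lookup-fromList (x ∷ xs) (px ∷ _)   zero    = px
All⇒lookup-fromList (x ∷ xs) (_  ∷ pxs) (suc i) = All⇒lookup-fromList xs pxs i

∈-++-drop : ∀ {a} {A : Set a} {b z : A} pre {post} → z ∈ pre ++ b ∷ post → z ≢ b → z ∈ pre ++ post
∈-++-drop []        (here z≡b) z≢b = ⊥-elim (z≢b z≡b)
∈-++-drop []        (there z∈) z≢b = z∈
∈-++-drop (_ ∷ pre) (here z≡x) z≢b = here z≡x
∈-++-drop (_ ∷ pre) (there z∈) z≢b = there (∈-++-drop pre z∈ z≢b)

length-≤-by-injection : ∀ {a b} {A : Set a} {B : Set b} (xs : List A) (ys : List B) → Unique xs →
  (f : ∀ {x} → x ∈ xs → B) →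
  (∀ {x y} (p : x ∈ xs) (q : y ∈ xs) → f p ≡ f q → x ≡ y) →
  (∀ {x} (p : x ∈ xs) → f p ∈ ys) → length xs ≤ length ys
length-≤-by-injection []       ys _                  f f-inj f∈ys = z≤n
length-≤-by-injection (x ∷ xs) ys (x∉xs AllPairs.∷ u) f f-inj f∈ys with ∈P.∈-∃++ (f∈ys (here refl))
... | pre , post , refl =
  ℕP.≤-trans (s≤s (length-≤-by-injection xs (pre ++ post) u (λ q → f (there q))
                     (λ p q → f-inj (there p) (there q))
                     (λ q → ∈-++-drop pre (f∈ys (there q))
                              (λ fq≡fx → All.lookup x∉xs q (sym (f-inj (there q) (here refl) fq≡fx))))))
             (ℕP.≤-reflexive (sym (ListP.length-++-sucʳ pre _ post)))

-- Colourings of a weighted graph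

module Colourings {k : ℕ} (G : WGraph k) where
  open WGraph G

  colourWeightℕ : ∀ {n} → Vec (Fin n) nV → ℕ → Fin k → ℕ
  colourWeightℕ κ c j = Σℕ (allFin nV) (λ v → when ⌊ toℕ (lookup κ v) ≟ c ⌋ (lookup (wt v) j))

  lookup-colourWeight : ∀ {n} (κ : Vec (Fin n) nV) c j →
    lookup (colourWeight G κ c) j ≡ colourWeightℕ κ (toℕ c) j
  lookup-colourWeight κ c j = trans (lookup-Σᵛ (allFin nV) _ j)
    (Σℕ-cong (allFin nV) (λ v → trans (lookup-if-0ᵏ _ (wt v) j)
      (cong (λ b → when b (lookup (wt v) j))
            (isYes-⇔ (cong toℕ) FinP.toℕ-injective (lookup κ v Fin.≟ c) (toℕ (lookup κ v) ≟ toℕ c)))))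

  colourWeightℕ-≥ : ∀ {n} (κ : Vec (Fin n) nV) c j → n ≤ c → colourWeightℕ κ c j ≡ 0
  colourWeightℕ-≥ κ c j n≤c = Σℕ-zero (allFin nV) λ v →
    cong (λ b → when b _) (isYes-false λ κv≡c →
      ℕP.<⇒≱ (FinP.toℕ<n (lookup κ v)) (subst (_ ≤_) (sym κv≡c) n≤c))

  -- Produces, with colours read as natural numbers so that colourings with different numbers of colours compare
  ProducesExt : ∀ {n} → Vec (Vec ℕ k) n → Vec (Fin n) nV → Set
  ProducesExt m κ = ∀ c j → colourWeightℕ κ c j ≡ lookup (ext m c) j

  produces⇒producesExt : ∀ {n} (m : Vec (Vec ℕ k) n) κ → Produces G m κ → ProducesExt m κ
  produces⇒producesExt {n} m κ P c j with c <? n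
  ... | yes c<n = begin
      colourWeightℕ κ c j                         ≡⟨ cong (λ c′ → colourWeightℕ κ c′ j) (sym (FinP.toℕ-fromℕ< c<n)) ⟩
      colourWeightℕ κ (toℕ (fromℕ< c<n)) j        ≡⟨ sym (lookup-colourWeight κ _ j) ⟩
      lookup (colourWeight G κ (fromℕ< c<n)) j    ≡⟨ cong (λ v → lookup v j) (P _) ⟩
      lookup (lookup m (fromℕ< c<n)) j            ≡⟨ cong (λ v → lookup v j) (sym (ext-toℕ m _)) ⟩
      lookup (ext m (toℕ (fromℕ< c<n))) j         ≡⟨ cong (λ c′ → lookup (ext m c′) j) (FinP.toℕ-fromℕ< c<n) ⟩
      lookup (ext m c) j                          ∎
    where open ≡-Reasoning
  ... | no c≮n = trans (colourWeightℕ-≥ κ c j (ℕP.≮⇒≥ c≮n))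
                  (sym (trans (cong (λ v → lookup v j) (ext-≥ m c (ℕP.≮⇒≥ c≮n))) (lookup-0ᵏ j)))

  producesExt⇒produces : ∀ {n} (m : Vec (Vec ℕ k) n) κ → ProducesExt m κ → Produces G m κ
  producesExt⇒produces m κ P c = lookup-ext _ _ λ j →
    trans (lookup-colourWeight κ c j) (trans (P (toℕ c) j) (cong (λ v → lookup v j) (ext-toℕ m c)))

  wt≤colourWeightℕ : ∀ {n} (κ : Vec (Fin n) nV) v j → lookup (wt v) j ≤ colourWeightℕ κ (toℕ (lookup κ v)) j
  wt≤colourWeightℕ κ v j = subst (_≤ colourWeightℕ κ (toℕ (lookup κ v)) j)
      (cong (λ b → when b (lookup (wt v) j)) (isYes-true refl))
      (∈⇒≤Σℕ (λ u → when ⌊ toℕ (lookup κ u) ≟ toℕ (lookup κ v) ⌋ (lookup (wt u) j)) (∈P.∈-allFin v))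

  producesExt⇒ext≢0ᵏ : ∀ {n} (m : Vec (Vec ℕ k) n) κ → ProducesExt m κ → ∀ v →
                       ext m (toℕ (lookup κ v)) ≢ 0ᵏ
  producesExt⇒ext≢0ᵏ m κ P v ext≡0 = wt-nz v (lookup-ext _ _ λ j →
    trans (ℕP.n≤0⇒n≡0 (subst (lookup (wt v) j ≤_)
            (trans (P _ j) (trans (cong (λ u → lookup u j) ext≡0) (lookup-0ᵏ j)))
            (wt≤colourWeightℕ κ v j)))
          (sym (lookup-0ᵏ j)))

  produces⇒lookup-multideg : ∀ {n} (m : Vec (Vec ℕ k) n) κ → Produces G m κ → ∀ j →
    lookup (multideg m) j ≡ Σℕ (allFin nV) (λ v → lookup (wt v) j)
  produces⇒lookup-multideg {n} m κ P j = begin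
      lookup (multideg m) j                                  ≡⟨ lookup-multideg m j ⟩
      ΣFin n (λ c → lookup (lookup m c) j)                   ≡⟨ ΣFin-cong n (λ c → trans (cong (λ u → lookup u j) (sym (P c)))
                                                                                         (lookup-colourWeight κ c j)) ⟩
      ΣFin n (λ c → colourWeightℕ κ (toℕ c) j)              ≡⟨ sym (Σℕ-allFin n _) ⟩
      Σℕ (allFin n) (λ c → colourWeightℕ κ (toℕ c) j)       ≡⟨ Σℕ-comm (allFin n) (allFin nV) _ ⟩
      Σℕ (allFin nV) (λ v → Σℕ (allFin n) (λ c → when ⌊ toℕ (lookup κ v) ≟ toℕ c ⌋ (lookup (wt v) j)))
        ≡⟨ Σℕ-cong (allFin nV) (λ v → trans (Σℕ-allFin n _) (ΣFin-indicator n (lookup κ v) _)) ⟩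
      Σℕ (allFin nV) (λ v → lookup (wt v) j)                 ∎
    where open ≡-Reasoning

  ProperProducing : ∀ {n} → Vec (Vec ℕ k) n → Vec (Fin n) nV → Set
  ProperProducing m κ = Proper G κ × Produces G m κ

  properProducing? : ∀ {n} (m : Vec (Vec ℕ k) n) κ → Dec (ProperProducing m κ)
  properProducing? m κ = proper? G κ ×-dec produces? G m κ

  properProducing : ∀ {n} → Vec (Vec ℕ k) n → List (Vec (Fin n) nV)
  properProducing {n} m = filter (properProducing? m) (allMaps n nV)

  ∈-properProducing⁻ : ∀ {n} {m : Vec (Vec ℕ k) n} {κ} → κ ∈ properProducing m → ProperProducing m κ
  ∈-properProducing⁻ {n} {m} κ∈ = proj₂ (∈P.∈-filter⁻ (properProducing? m) {xs = allMaps n nV} κ∈)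

  ∈-properProducing⁺ : ∀ {n} {m : Vec (Vec ℕ k) n} {κ} → ProperProducing m κ → κ ∈ properProducing m
  ∈-properProducing⁺ {n} {m} {κ} pp = ∈P.∈-filter⁺ (properProducing? m) (∈-allMaps n nV κ) pp

  coeffX≡0⊎properProducing : ∀ {n} (m : Vec (Vec ℕ k) n) → coeffX G m ≡ 0 ⊎ ∃ (ProperProducing m)
  coeffX≡0⊎properProducing m with properProducing m in eq
  ... | []    = inj₁ refl
  ... | κ ∷ _ = inj₂ (κ , ∈-properProducing⁻ {m = m} (subst (κ ∈_) (sym eq) (here refl)))

  -- colour c of a colouring producing m becomes colour σ⁻¹ c of one producing m′
  module Relabel (σ : ℕ ↔ ℕ) {n n′} (m : Vec (Vec ℕ k) n) (m′ : Vec (Vec ℕ k) n′)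
                 (m′≗m∘σ : ∀ i → ext m′ i ≡ ext m (Inverse.to σ i)) where
    open Inverse σ using (to; from; strictlyInverseˡ; strictlyInverseʳ)

    relabel-< : ∀ κ → ProducesExt m κ → ∀ v → from (toℕ (lookup κ v)) < n′
    relabel-< κ P v = ext≢0ᵏ⇒< m′ _ λ ext≡0 → producesExt⇒ext≢0ᵏ m κ P v
      (trans (sym (trans (m′≗m∘σ _) (cong (ext m) (strictlyInverseˡ _)))) ext≡0)

    relabel : ∀ κ → ProducesExt m κ → Vec (Fin n′) nV
    relabel κ P = Vec.tabulate (λ v → fromℕ< (relabel-< κ P v))

    toℕ-relabel : ∀ κ P v → toℕ (lookup (relabel κ P) v) ≡ from (toℕ (lookup κ v))
    toℕ-relabel κ P v = trans (cong toℕ (VecP.lookup∘tabulate _ v)) (FinP.toℕ-fromℕ< _)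

    from-injective : ∀ {x y} → from x ≡ from y → x ≡ y
    from-injective {x} {y} eq = trans (sym (strictlyInverseˡ x)) (trans (cong to eq) (strictlyInverseˡ y))

    relabel-injective : ∀ κ₁ P₁ κ₂ P₂ → relabel κ₁ P₁ ≡ relabel κ₂ P₂ → κ₁ ≡ κ₂
    relabel-injective κ₁ P₁ κ₂ P₂ eq = lookup-ext _ _ λ v → FinP.toℕ-injective (from-injective
      (trans (sym (toℕ-relabel κ₁ P₁ v)) (trans (cong (λ u → toℕ (lookup u v)) eq) (toℕ-relabel κ₂ P₂ v))))

    relabel-proper : ∀ κ P → Proper G κ → Proper G (relabel κ P)
    relabel-proper κ P proper u v uv eq = proper u v uv (FinP.toℕ-injective (from-injective
      (trans (sym (toℕ-relabel κ P u)) (trans (cong toℕ eq) (toℕ-relabel κ P v)))))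

    relabel-producesExt : ∀ κ P → ProducesExt m′ (relabel κ P)
    relabel-producesExt κ P c j = begin
      colourWeightℕ (relabel κ P) c j ≡⟨ Σℕ-cong (allFin nV) (λ v → cong (λ b → when b (lookup (wt v) j))
                                           (trans (cong (λ x → ⌊ x ≟ c ⌋) (toℕ-relabel κ P v)) (from≟⇔≟to _))) ⟩
      colourWeightℕ κ (to c) j         ≡⟨ P (to c) j ⟩
      lookup (ext m (to c)) j          ≡⟨ cong (λ u → lookup u j) (sym (m′≗m∘σ c)) ⟩
      lookup (ext m′ c) j              ∎
      where
      open ≡-Reasoning
      from≟⇔≟to : ∀ x → ⌊ from x ≟ c ⌋ ≡ ⌊ x ≟ to c ⌋
      from≟⇔≟to x = isYes-⇔ (λ eq → trans (sym (strictlyInverseˡ x)) (cong to eq))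
                            (λ eq → trans (cong from eq) (strictlyInverseʳ c)) (from x ≟ c) (x ≟ to c)

    producesExtOf : ∀ {κ} → κ ∈ properProducing m → ProducesExt m κ
    producesExtOf {κ} κ∈ = produces⇒producesExt m κ (proj₂ (∈-properProducing⁻ {m = m} κ∈))

    relabelMember : ∀ {κ} → κ ∈ properProducing m → Vec (Fin n′) nV
    relabelMember {κ} κ∈ = relabel κ (producesExtOf κ∈)

    relabelMember-properProducing : ∀ {κ} (κ∈ : κ ∈ properProducing m) → relabelMember κ∈ ∈ properProducing m′
    relabelMember-properProducing {κ} κ∈ with ∈-properProducing⁻ {m = m} κ∈
    ... | proper , P = ∈-properProducing⁺ {m = m′}
      (relabel-proper κ Pext proper , producesExt⇒produces m′ (relabel κ Pext) (relabel-producesExt κ Pext))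
      where Pext = produces⇒producesExt m κ P

    length-properProducing-≤ : length (properProducing m) ≤ length (properProducing m′)
    length-properProducing-≤ =
      length-≤-by-injection (properProducing m) (properProducing m′)
        (UniqueP.filter⁺ (properProducing? m) (allMaps-unique n nV))
        relabelMember
        (λ {κ₁} {κ₂} p q → relabel-injective κ₁ (producesExtOf p) κ₂ (producesExtOf q))
        relabelMember-properProducing

  coeffX-relabel : ∀ (σ : ℕ ↔ ℕ) {n} (m : Vec (Vec ℕ k) n) {n′} (m′ : Vec (Vec ℕ k) n′) →
                   (∀ i → ext m′ i ≡ ext m (Inverse.to σ i)) → coeffX G m′ ≡ coeffX G m
  coeffX-relabel σ m m′ m′≗m∘σ = ℕP.≤-antisym
    (Relabel.length-properProducing-≤ (↔-sym σ) m′ m m≗m′∘σ⁻¹)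
    (Relabel.length-properProducing-≤ σ m m′ m′≗m∘σ)
    where
    m≗m′∘σ⁻¹ : ∀ i → ext m i ≡ ext m′ (Inverse.from σ i)
    m≗m′∘σ⁻¹ i = sym (trans (m′≗m∘σ _) (cong (ext m) (Inverse.strictlyInverseˡ σ i)))

-- The graph I^λ

εWeight : ∀ {k} → Fin k → ℕ × Fin k → ℕ
εWeight j x = lookup (ε (proj₂ x)) j

partεWeight : ∀ {k} → Fin k → ℕ → ℕ × Fin k → ℕ
partεWeight j c x = when ⌊ proj₁ x ≟ c ⌋ (εWeight j x)

Σℕ-partVerts : ∀ {k} t (a : Vec ℕ k) (g : ℕ × Fin k → ℕ) →
  Σℕ (partVerts t a) g ≡ Σℕ (allFin k) (λ i → lookup a i * g (t , i))
Σℕ-partVerts {k} t a g = trans (Σℕ-concatMap (λ i → List.replicate (lookup a i) (t , i)) (allFin k) g)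
  (Σℕ-cong (allFin k) (λ i → Σℕ-replicate (lookup a i) (t , i) g))

Σℕ-partVerts-ε : ∀ {k} t (a : Vec ℕ k) j → Σℕ (partVerts t a) (εWeight j) ≡ lookup a j
Σℕ-partVerts-ε {k} t a j = begin
    Σℕ (partVerts t a) (εWeight j)                            ≡⟨ Σℕ-partVerts t a (εWeight j) ⟩
    Σℕ (allFin k) (λ i → lookup a i * lookup (ε i) j)          ≡⟨ Σℕ-cong (allFin k) coordinate ⟩
    Σℕ (allFin k) (λ i → when ⌊ toℕ j ≟ toℕ i ⌋ (lookup a i))  ≡⟨ Σℕ-allFin k _ ⟩
    ΣFin k (λ i → when ⌊ toℕ j ≟ toℕ i ⌋ (lookup a i))         ≡⟨ ΣFin-indicator k j (lookup a) ⟩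
    lookup a j                                                 ∎
  where
  open ≡-Reasoning
  coordinate : ∀ i → lookup a i * lookup (ε i) j ≡ when ⌊ toℕ j ≟ toℕ i ⌋ (lookup a i)
  coordinate i = trans (cong (lookup a i *_) (lookup-ε i j))
    (trans (*-when (lookup a i) _ 1) (cong (when ⌊ toℕ j ≟ toℕ i ⌋) (ℕP.*-identityʳ (lookup a i))))

Σℕ-vertsFrom-ε : ∀ {k} t (λs : List (Vec ℕ k)) j → Σℕ (vertsFrom t λs) (εWeight j) ≡ Σℕ λs (λ a → lookup a j)
Σℕ-vertsFrom-ε t []       j = refl
Σℕ-vertsFrom-ε t (a ∷ λs) j = trans (Σℕ-++ (partVerts t a) (vertsFrom (suc t) λs) _)
  (cong₂ _+_ (Σℕ-partVerts-ε t a j) (Σℕ-vertsFrom-ε (suc t) λs j))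

Σℕ-partVerts-part : ∀ {k} t (a : Vec ℕ k) j c →
  Σℕ (partVerts t a) (partεWeight j c) ≡ when ⌊ t ≟ c ⌋ (lookup a j)
Σℕ-partVerts-part {k} t a j c = begin
    Σℕ (partVerts t a) (partεWeight j c)                              ≡⟨ Σℕ-partVerts t a _ ⟩
    Σℕ (allFin k) (λ i → lookup a i * when b (lookup (ε i) j))         ≡⟨ Σℕ-cong (allFin k) (λ i → *-when (lookup a i) b _) ⟩
    Σℕ (allFin k) (λ i → when b (lookup a i * lookup (ε i) j))         ≡⟨ Σℕ-when (allFin k) b _ ⟩
    when b (Σℕ (allFin k) (λ i → lookup a i * lookup (ε i) j))         ≡⟨ cong (when b) (sym (Σℕ-partVerts t a (εWeight j))) ⟩
    when b (Σℕ (partVerts t a) (εWeight j))                           ≡⟨ cong (when b) (Σℕ-partVerts-ε t a j) ⟩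
    when b (lookup a j)                                               ∎
  where
  open ≡-Reasoning
  b = ⌊ t ≟ c ⌋

Σℕ-vertsFrom-before : ∀ {k} t (λs : List (Vec ℕ k)) j c → c < t → Σℕ (vertsFrom t λs) (partεWeight j c) ≡ 0
Σℕ-vertsFrom-before t []       j c c<t = refl
Σℕ-vertsFrom-before t (a ∷ λs) j c c<t = trans (Σℕ-++ (partVerts t a) (vertsFrom (suc t) λs) _)
  (cong₂ _+_ (trans (Σℕ-partVerts-part t a j c)
                    (cong (λ b → when b (lookup a j)) (isYes-false λ t≡c → ℕP.<-irrefl (sym t≡c) c<t)))
             (Σℕ-vertsFrom-before (suc t) λs j c (ℕP.m<n⇒m<1+n c<t)))

Σℕ-vertsFrom-part : ∀ {k} t (λs : List (Vec ℕ k)) j c →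
  Σℕ (vertsFrom t λs) (partεWeight j (t + c)) ≡ lookup (ext (Vec.fromList λs) c) j
Σℕ-vertsFrom-part t []       j c = sym (lookup-0ᵏ j)
Σℕ-vertsFrom-part t (a ∷ λs) j zero rewrite ℕP.+-identityʳ t =
  trans (Σℕ-++ (partVerts t a) (vertsFrom (suc t) λs) (partεWeight j t))
    (trans (cong₂ _+_ (trans (Σℕ-partVerts-part t a j t) (cong (λ b → when b (lookup a j)) (isYes-true refl)))
                      (Σℕ-vertsFrom-before (suc t) λs j t (ℕP.n<1+n t)))
           (ℕP.+-identityʳ (lookup a j)))
Σℕ-vertsFrom-part t (a ∷ λs) j (suc c) rewrite ℕP.+-suc t c =
  trans (Σℕ-++ (partVerts t a) (vertsFrom (suc t) λs) (partεWeight j (suc (t + c))))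
    (cong₂ _+_ (trans (Σℕ-partVerts-part t a j _) (cong (λ b → when b (lookup a j)) (isYes-false (ℕP.m≢1+m+n t))))
               (Σℕ-vertsFrom-part (suc t) λs j c))

Σℕ-wt-I : ∀ {k} (λk : KPart k) j →
  Σℕ (allFin (WGraph.nV (I λk))) (λ v → lookup (WGraph.wt (I λk) v) j) ≡ lookup ∣ λk ∣ j
Σℕ-wt-I (λs , _) j =
  trans (Σℕ-allFin (length (vertsFrom 0 λs)) (λ v → εWeight j (List.lookup (vertsFrom 0 λs) v))) 
    (trans (ΣFin-lookup (vertsFrom 0 λs) (εWeight j))
    (trans (Σℕ-vertsFrom-ε 0 λs j) (sym (lookup-Σᵛ λs (λ a → a) j))))

produces⇒multideg≡∣∣ : ∀ {k} (λk : KPart k) {n} (m : Vec (Vec ℕ k) n) κ →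
  Produces (I λk) m κ → multideg m ≡ ∣ λk ∣
produces⇒multideg≡∣∣ λk m κ P =
  lookup-ext _ _ λ j → trans (Colourings.produces⇒lookup-multideg (I λk) m κ P j) (Σℕ-wt-I λk j)

-- Permutations from injections

toList-removeAt : ∀ {a} {A : Set a} {n} (ys : Vec A (suc n)) (p : Fin (suc n)) →
  Vec.toList ys ↭ lookup ys p ∷ Vec.toList (Vec.removeAt ys p)
toList-removeAt (y ∷ ys)     zero    = ↭-refl
toList-removeAt (y ∷ z ∷ ys) (suc p) = ↭-trans (↭-prep y (toList-removeAt (z ∷ ys) p)) (↭-swap y _ ↭-refl)

injection⇒↭ : ∀ {a} {A : Set a} {n} (xs ys : Vec A n) (φ : Fin n → Fin n) →
  (∀ {i j} → φ i ≡ φ j → i ≡ j) → (∀ i → lookup ys (φ i) ≡ lookup xs i) → Vec.toList xs ↭ Vec.toList ys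
injection⇒↭ []       []  φ φ-inj ys∘φ≗xs = ↭-refl
injection⇒↭ {n = suc n} (x ∷ xs) ys φ φ-inj ys∘φ≗xs =
  ↭-sym (↭-trans (toList-removeAt ys (φ zero))
    (subst (λ z → z ∷ Vec.toList (Vec.removeAt ys (φ zero)) ↭ x ∷ Vec.toList xs) (sym (ys∘φ≗xs zero))
      (↭-prep x (↭-sym (injection⇒↭ xs (Vec.removeAt ys (φ zero)) φ′ φ′-inj ys′∘φ′≗xs)))))
  where
  φ0≢φsuc : ∀ j → φ zero ≢ φ (suc j)
  φ0≢φsuc j eq with φ-inj eq
  ... | ()
  φ′ : Fin n → Fin n
  φ′ j = Fin.punchOut (φ0≢φsuc j)
  φ′-inj : ∀ {i j} → φ′ i ≡ φ′ j → i ≡ j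
  φ′-inj eq = FinP.suc-injective (φ-inj (FinP.punchOut-injective (φ0≢φsuc _) (φ0≢φsuc _) eq))
  ys′∘φ′≗xs : ∀ i → lookup (Vec.removeAt ys (φ zero)) (φ′ i) ≡ lookup xs i
  ys′∘φ′≗xs i = trans (VecP.removeAt-punchOut ys (φ0≢φsuc i)) (ys∘φ≗xs (suc i))

injection⇒↭ᴸ : ∀ {a} {A : Set a} (xs ys : List A) → length xs ≡ length ys →
  (φ : Fin (length xs) → Fin (length ys)) → (∀ {i j} → φ i ≡ φ j → i ≡ j) →
  (∀ i → lookup (Vec.fromList ys) (φ i) ≡ lookup (Vec.fromList xs) i) → xs ↭ ys
injection⇒↭ᴸ xs ys eq φ φ-inj ys∘φ≗xs = subst₂ _↭_ (VecP.toList∘fromList xs) (VecP.toList∘fromList ys)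
  (vecs (Vec.fromList xs) (Vec.fromList ys) eq φ φ-inj ys∘φ≗xs)
  where
  vecs : ∀ {m n} (u : Vec _ m) (w : Vec _ n) → m ≡ n → (φ : Fin m → Fin n) →
         (∀ {i j} → φ i ≡ φ j → i ≡ j) → (∀ i → lookup w (φ i) ≡ lookup u i) → Vec.toList u ↭ Vec.toList w
  vecs u w refl = injection⇒↭ u w

module Multipartite {k : ℕ} (λs : List (Vec ℕ k)) (λs≢0 : All (_≢ 0ᵏ) λs) where
  open WGraph (I (λs , λs≢0))
  open Colourings (I (λs , λs≢0))

  part : Fin nV → ℕ
  part v = proj₁ (List.lookup (vertsFrom 0 λs) v)

  partWeight : ∀ c j →
    Σℕ (allFin nV) (λ v → when ⌊ part v ≟ c ⌋ (lookup (wt v) j)) ≡ lookup (ext (Vec.fromList λs) c) j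
  partWeight c j = trans (Σℕ-allFin nV _)
    (trans (ΣFin-lookup (vertsFrom 0 λs) (partεWeight j c)) (Σℕ-vertsFrom-part 0 λs j c))

  partWeight-toℕ : ∀ t j →
    Σℕ (allFin nV) (λ v → when ⌊ part v ≟ toℕ t ⌋ (lookup (wt v) j)) ≡ lookup (lookup (Vec.fromList λs) t) j
  partWeight-toℕ t j = trans (partWeight (toℕ t) j) (cong (λ u → lookup u j) (ext-toℕ (Vec.fromList λs) t))

  part< : ∀ v → part v < length λs
  part< v = ext≢0ᵏ⇒< (Vec.fromList λs) (part v) λ ext≡0 → ℕP.1+n≰n (subst (1 ≤_) (weight≡0 ext≡0) 1≤weight)
    where
    i : Fin k
    i = proj₂ (List.lookup (vertsFrom 0 λs) v)
    weightOf : Fin nV → ℕ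
    weightOf u = when ⌊ part u ≟ part v ⌋ (lookup (wt u) i)
    weight≡0 : ext (Vec.fromList λs) (part v) ≡ 0ᵏ → Σℕ (allFin nV) weightOf ≡ 0
    weight≡0 ext≡0 = trans (partWeight (part v) i) (trans (cong (λ u → lookup u i) ext≡0) (lookup-0ᵏ i))
    weightOf-v : weightOf v ≡ 1
    weightOf-v rewrite isYes-true {part v} refl | lookup-ε i i | isYes-true {toℕ i} refl = refl
    1≤weight : 1 ≤ Σℕ (allFin nV) weightOf
    1≤weight = subst (_≤ Σℕ (allFin nV) weightOf) weightOf-v (∈⇒≤Σℕ weightOf (∈P.∈-allFin v))

  canonical : Vec (Fin (length λs)) nV
  canonical = Vec.tabulate (λ v → fromℕ< (part< v))

  toℕ-canonical : ∀ v → toℕ (lookup canonical v) ≡ part v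
  toℕ-canonical v = trans (cong toℕ (VecP.lookup∘tabulate _ v)) (FinP.toℕ-fromℕ< _)

  canonical-properProducing : ProperProducing (Vec.fromList λs) canonical
  canonical-properProducing =
      (λ u v uv eq → uv (trans (sym (toℕ-canonical u)) (trans (cong toℕ eq) (toℕ-canonical v))))
    , producesExt⇒produces (Vec.fromList λs) canonical λ c j →
        trans (Σℕ-cong (allFin nV) (λ v → cong (λ x → when ⌊ x ≟ c ⌋ (lookup (wt v) j)) (toℕ-canonical v)))
              (partWeight c j)

  coeffX-diagonal-positive : 0 < coeffX (I (λs , λs≢0)) (Vec.fromList λs)
  coeffX-diagonal-positive = ∈P.∈-length (∈-properProducing⁺ {m = Vec.fromList λs} {canonical} canonical-properProducing)

  module ColouringOf (μs : List (Vec ℕ k)) (κ : Vec (Fin (length μs)) nV)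
                     (proper : Proper (I (λs , λs≢0)) κ) (P : Produces (I (λs , λs≢0)) (Vec.fromList μs) κ) where

    -- parts are nonempty because the λ_t are nonzero
    representative : (t : Fin (length λs)) → Σ (Fin nV) (λ v → part v ≡ toℕ t)
    representative t with ≢0ᵏ⇒∃ (lookup (Vec.fromList λs) t) (All⇒lookup-fromList λs λs≢0 t)
    ... | j , λtj≢0 with Σℕ≢0⇒∃ (allFin nV) (λ v → when ⌊ part v ≟ toℕ t ⌋ (lookup (wt v) j))
                                 (λ Σ≡0 → λtj≢0 (trans (sym (partWeight-toℕ t j)) Σ≡0))
    ... | v , w≢0 = v , when-≢0 (part v) (toℕ t) _ w≢0

    colourOfPart : Fin (length λs) → Fin (length μs)
    colourOfPart t = lookup κ (proj₁ (representative t))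

    colourOfPart-injective : ∀ {t t′} → colourOfPart t ≡ colourOfPart t′ → t ≡ t′
    colourOfPart-injective {t} {t′} eq with t Fin.≟ t′
    ... | yes t≡t′ = t≡t′
    ... | no  t≢t′ = ⊥-elim (proper (proj₁ (representative t)) (proj₁ (representative t′))
            (λ parts≡ → t≢t′ (FinP.toℕ-injective
              (trans (sym (proj₂ (representative t))) (trans parts≡ (proj₂ (representative t′)))))) eq)

    length-≤ : length λs ≤ length μs
    length-≤ = FinP.injective⇒≤ colourOfPart-injective

    colour⇒part : ∀ v t → lookup κ v ≡ colourOfPart t → part v ≡ toℕ t
    colour⇒part v t eq with part v ≟ toℕ t
    ... | yes part≡ = part≡
    ... | no  part≢ = ⊥-elim (proper v (proj₁ (representative t))
                                (λ eq′ → part≢ (trans eq′ (proj₂ (representative t)))) eq)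

    module SameLength (len≡ : length λs ≡ length μs) where
      colourOfPart-surjective : ∀ c → ∃ λ t → colourOfPart t ≡ c
      colourOfPart-surjective c with FinP.any? (λ t → colourOfPart t Fin.≟ c)
      ... | yes hit = hit
      ... | no  miss = ⊥-elim (ℕP.<-irrefl refl (subst (suc (length λs) ≤_) (sym len≡) (FinP.injective⇒≤ g-inj)))
        where
        g : Fin (suc (length λs)) → Fin (length μs)
        g zero    = c
        g (suc t) = colourOfPart t
        g-inj : ∀ {x y} → g x ≡ g y → x ≡ y
        g-inj {zero}  {zero}  _  = refl
        g-inj {zero}  {suc y} eq = ⊥-elim (miss (y , sym eq))
        g-inj {suc x} {zero}  eq = ⊥-elim (miss (x , eq))
        g-inj {suc x} {suc y} eq = cong suc (colourOfPart-injective eq)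

      part⇒colour : ∀ v t → part v ≡ toℕ t → lookup κ v ≡ colourOfPart t
      part⇒colour v t part≡ with colourOfPart-surjective (lookup κ v)
      ... | t′ , eq with FinP.toℕ-injective {i = t} {j = t′} (trans (sym part≡) (colour⇒part v t′ (sym eq)))
      ... | refl = sym eq

      weight-colourOfPart : ∀ t → lookup (Vec.fromList μs) (colourOfPart t) ≡ lookup (Vec.fromList λs) t
      weight-colourOfPart t = lookup-ext _ _ λ j → begin
          lookup (lookup m (colourOfPart t)) j              ≡⟨ cong (λ u → lookup u j) (sym (ext-toℕ m (colourOfPart t))) ⟩
          lookup (ext m (toℕ (colourOfPart t))) j           ≡⟨ sym (produces⇒producesExt m κ P _ j) ⟩
          colourWeightℕ κ (toℕ (colourOfPart t)) j          ≡⟨ Σℕ-cong (allFin nV) (λ v → cong (λ b → when b (lookup (wt v) j))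
                                                                 (isYes-⇔ (λ e → colour⇒part v t (FinP.toℕ-injective e))
                                                                          (λ e → cong toℕ (part⇒colour v t e)) _ _)) ⟩
          Σℕ (allFin nV) (λ v → when ⌊ part v ≟ toℕ t ⌋ (lookup (wt v) j)) ≡⟨ partWeight-toℕ t j ⟩
          lookup (lookup (Vec.fromList λs) t) j             ∎
        where
        open ≡-Reasoning
        m = Vec.fromList μs

      λs↭μs : λs ↭ μs
      λs↭μs = injection⇒↭ᴸ λs μs len≡ colourOfPart colourOfPart-injective weight-colourOfPart

coeffX-I-triangular : ∀ {k} (ν : KPart k) (μs : List (Vec ℕ k)) →
  coeffX (I ν) (Vec.fromList μs) ≡ 0 ⊎
  (length (proj₁ ν) ≤ length μs × (length (proj₁ ν) ≡ length μs → proj₁ ν ↭ μs))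
coeffX-I-triangular (νs , νs≢0) μs with Colourings.coeffX≡0⊎properProducing (I (νs , νs≢0)) (Vec.fromList μs)
... | inj₁ coeff≡0             = inj₁ coeff≡0
... | inj₂ (κ , proper , P)    = inj₂ (length-≤ , SameLength.λs↭μs)
  where open Multipartite.ColouringOf νs νs≢0 μs κ proper P

-- Renaming variables

infix 4 _≋_

record _≋_ {k n n′} (m : Vec (Vec ℕ k) n) (m′ : Vec (Vec ℕ k) n′) : Set where
  constructor via
  field
    σ      : ℕ ↔ ℕ
    ext-σ  : ∀ i → ext m′ i ≡ ext m (Inverse.to σ i)

ext⇒≋ : ∀ {k n n′} {m : Vec (Vec ℕ k) n} {m′ : Vec (Vec ℕ k) n′} → (∀ i → ext m′ i ≡ ext m i) → m ≋ m′
ext⇒≋ m′≗m = via ↔-refl m′≗m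

≋-refl : ∀ {k n} {m : Vec (Vec ℕ k) n} → m ≋ m
≋-refl = ext⇒≋ (λ _ → refl)

≋-trans : ∀ {k n n′ n″} {m : Vec (Vec ℕ k) n} {m′ : Vec (Vec ℕ k) n′} {m″ : Vec (Vec ℕ k) n″} →
  m ≋ m′ → m′ ≋ m″ → m ≋ m″
≋-trans (via σ m′≗m∘σ) (via τ m″≗m′∘τ) =
  via (↔-trans τ σ) λ i → trans (m″≗m′∘τ i) (m′≗m∘σ _)

≋-cons : ∀ {k n n′} (x : Vec ℕ k) {m : Vec (Vec ℕ k) n} {m′ : Vec (Vec ℕ k) n′} →
  m ≋ m′ → (x ∷ m) ≋ (x ∷ m′)
≋-cons x (via σ m′≗m∘σ) = via (mk↔ₛ′ (lift to) (lift from) (lift-inverse to from strictlyInverseˡ)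
                                                    (lift-inverse from to strictlyInverseʳ))
                      λ { zero → refl ; (suc i) → m′≗m∘σ i }
  where
  open Inverse σ
  lift : (ℕ → ℕ) → ℕ → ℕ
  lift f zero    = zero
  lift f (suc x) = suc (f x)
  lift-inverse : ∀ f g → (∀ x → f (g x) ≡ x) → ∀ x → lift f (lift g x) ≡ x
  lift-inverse f g fg zero    = refl
  lift-inverse f g fg (suc x) = cong suc (fg x)

≋-swap : ∀ {k n} (x y : Vec ℕ k) (m : Vec (Vec ℕ k) n) → (x ∷ y ∷ m) ≋ (y ∷ x ∷ m)
≋-swap x y m = via (mk↔ₛ′ swap01 swap01 involutive involutive)
             λ { zero → refl ; (suc zero) → refl ; (suc (suc i)) → refl }
  where
  swap01 : ℕ → ℕ
  swap01 zero          = suc zero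
  swap01 (suc zero)    = zero
  swap01 (suc (suc x)) = suc (suc x)
  involutive : ∀ x → swap01 (swap01 x) ≡ x
  involutive zero          = refl
  involutive (suc zero)    = refl
  involutive (suc (suc x)) = refl

↭⇒≋ : ∀ {k} {xs ys : List (Vec ℕ k)} → xs ↭ ys → Vec.fromList xs ≋ Vec.fromList ys
↭⇒≋ _↭_.refl           = ≋-refl
↭⇒≋ (_↭_.prep x p)     = ≋-cons x (↭⇒≋ p)
↭⇒≋ (_↭_.swap x y p)   = ≋-trans (≋-swap x y _) (≋-cons y (≋-cons x (↭⇒≋ p)))
↭⇒≋ (_↭_.trans p q)    = ≋-trans (↭⇒≋ p) (↭⇒≋ q)

0ᵏ∷≋∷ʳ0ᵏ : ∀ {k n} (m : Vec (Vec ℕ k) n) → (0ᵏ ∷ m) ≋ (m Vec.∷ʳ 0ᵏ)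
0ᵏ∷≋∷ʳ0ᵏ []      = ≋-refl
0ᵏ∷≋∷ʳ0ᵏ (a ∷ m) = ≋-trans (≋-swap 0ᵏ a m) (≋-cons a (0ᵏ∷≋∷ʳ0ᵏ m))

ext-∷ʳ0ᵏ : ∀ {k n} (m : Vec (Vec ℕ k) n) i → ext (m Vec.∷ʳ 0ᵏ) i ≡ ext m i
ext-∷ʳ0ᵏ []      zero    = refl
ext-∷ʳ0ᵏ []      (suc i) = refl
ext-∷ʳ0ᵏ (a ∷ m) zero    = refl
ext-∷ʳ0ᵏ (a ∷ m) (suc i) = ext-∷ʳ0ᵏ m i

dropZeros : ∀ {k n} → Vec (Vec ℕ k) n → List (Vec ℕ k)
dropZeros []      = []
dropZeros (a ∷ m) with VecP.≡-dec _≟_ a 0ᵏ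
... | yes _ = dropZeros m
... | no  _ = a ∷ dropZeros m

dropZeros-≢0ᵏ : ∀ {k n} (m : Vec (Vec ℕ k) n) → All (_≢ 0ᵏ) (dropZeros m)
dropZeros-≢0ᵏ []      = []
dropZeros-≢0ᵏ (a ∷ m) with VecP.≡-dec _≟_ a 0ᵏ
... | yes _   = dropZeros-≢0ᵏ m
... | no  a≢0 = a≢0 ∷ dropZeros-≢0ᵏ m

≋-dropZeros : ∀ {k n} (m : Vec (Vec ℕ k) n) → m ≋ Vec.fromList (dropZeros m)
≋-dropZeros []      = ≋-refl
≋-dropZeros (a ∷ m) with VecP.≡-dec _≟_ a 0ᵏ
... | yes refl = ≋-trans (≋-cons 0ᵏ (≋-dropZeros m))
                   (≋-trans (0ᵏ∷≋∷ʳ0ᵏ _) (ext⇒≋ (λ i → sym (ext-∷ʳ0ᵏ (Vec.fromList (dropZeros m)) i))))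
... | no  _    = ≋-cons a (≋-dropZeros m)

Σᵛ-dropZeros : ∀ {k n} (m : Vec (Vec ℕ k) n) → List.foldr _+ᵛ_ 0ᵏ (dropZeros m) ≡ multideg m
Σᵛ-dropZeros []      = refl
Σᵛ-dropZeros (a ∷ m) with VecP.≡-dec _≟_ a 0ᵏ
... | yes refl = trans (Σᵛ-dropZeros m)
                   (lookup-ext _ _ λ j → sym (trans (lookup-+ᵛ 0ᵏ _ j) (cong (_+ lookup (multideg m) j) (lookup-0ᵏ j))))
... | no  _    = cong (a +ᵛ_) (Σᵛ-dropZeros m)

-- Enumerating the k-tuple partitions of a multidegree

Σᵛ : ∀ {k} → List (Vec ℕ k) → Vec ℕ k
Σᵛ = List.foldr _+ᵛ_ 0ᵏ

∈-concatMap⁺ : ∀ {a b} {A : Set a} {B : Set b} (f : A → List B) {x xs y} → y ∈ f x → x ∈ xs → y ∈ concatMap f xs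
∈-concatMap⁺ f y∈fx x∈xs = ∈P.∈-concatMap⁺ f (lose x∈xs y∈fx)

∈-concatMap⁻ : ∀ {a b} {A : Set a} {B : Set b} (f : A → List B) {xs y} →
  y ∈ concatMap f xs → ∃ λ x → x ∈ xs × y ∈ f x
∈-concatMap⁻ f y∈ = find (∈P.∈-concatMap⁻ f y∈)

splitsℕ : ℕ → List (ℕ × ℕ)
splitsℕ zero    = (0 , 0) ∷ []
splitsℕ (suc x) = (0 , suc x) ∷ map (λ (i , j) → (suc i , j)) (splitsℕ x)

∈-splitsℕ⁻ : ∀ x {i j} → (i , j) ∈ splitsℕ x → i + j ≡ x
∈-splitsℕ⁻ zero    (here refl) = refl
∈-splitsℕ⁻ (suc x) (here refl) = refl
∈-splitsℕ⁻ (suc x) (there ij∈) with ∈P.∈-map⁻ _ ij∈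
... | _ , ij∈′ , refl = cong suc (∈-splitsℕ⁻ x ij∈′)

∈-splitsℕ⁺ : ∀ i j → (i , j) ∈ splitsℕ (i + j)
∈-splitsℕ⁺ zero    zero    = here refl
∈-splitsℕ⁺ zero    (suc j) = here refl
∈-splitsℕ⁺ (suc i) j       = there (∈P.∈-map⁺ (λ (i , j) → (suc i , j)) (∈-splitsℕ⁺ i j))

splits : ∀ {k} → Vec ℕ k → List (Vec ℕ k × Vec ℕ k)
splits []      = ([] , []) ∷ []
splits (x ∷ d) = concatMap (λ (i , j) → map (λ (a , b) → (i ∷ a , j ∷ b)) (splits d)) (splitsℕ x)

∈-splits⁻ : ∀ {k} (d : Vec ℕ k) {a b} → (a , b) ∈ splits d → a +ᵛ b ≡ d
∈-splits⁻ []      {[]} {[]} (here refl) = refl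
∈-splits⁻ (x ∷ d) ab∈ with ∈-concatMap⁻ _ {xs = splitsℕ x} ab∈
... | (i , j) , ij∈ , ab∈′ with ∈P.∈-map⁻ _ ab∈′
... | _ , ab∈″ , refl = cong₂ _∷_ (∈-splitsℕ⁻ x ij∈) (∈-splits⁻ d ab∈″)

∈-splits⁺ : ∀ {k} (a b : Vec ℕ k) → (a , b) ∈ splits (a +ᵛ b)
∈-splits⁺ []      []      = here refl
∈-splits⁺ (i ∷ a) (j ∷ b) =
  ∈-concatMap⁺ _ (∈P.∈-map⁺ (λ (a , b) → (i ∷ a , j ∷ b)) (∈-splits⁺ a b)) (∈-splitsℕ⁺ i j)

consNonzero : ∀ {k} (a : Vec ℕ k) → Dec (a ≡ 0ᵏ) → List (KPart k) → List (KPart k)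
consNonzero a (yes _)   _  = []
consNonzero a (no  a≢0) μs = map (λ (μ , μ≢0) → (a ∷ μ , a≢0 ∷ μ≢0)) μs

kPartsOfLength : ∀ {k} → ℕ → Vec ℕ k → List (KPart k)
kPartsOfLength zero d with VecP.≡-dec _≟_ d 0ᵏ
... | yes _ = ([] , []) ∷ []
... | no  _ = []
kPartsOfLength (suc ℓ) d =
  concatMap (λ (a , b) → consNonzero a (VecP.≡-dec _≟_ a 0ᵏ) (kPartsOfLength ℓ b)) (splits d)

∈-kPartsOfLength⁻ : ∀ {k} ℓ (d : Vec ℕ k) {p} →
  p ∈ kPartsOfLength ℓ d → ∣ p ∣ ≡ d × length (proj₁ p) ≡ ℓ
∈-kPartsOfLength⁻ zero d p∈ with VecP.≡-dec _≟_ d 0ᵏ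
∈-kPartsOfLength⁻ zero d (here refl) | yes d≡0 = sym d≡0 , refl
∈-kPartsOfLength⁻ (suc ℓ) d p∈ with ∈-concatMap⁻ _ {xs = splits d} p∈
... | (a , b) , ab∈ , p∈′ with VecP.≡-dec _≟_ a 0ᵏ
... | no _ with ∈P.∈-map⁻ _ p∈′
... | _ , p∈″ , refl with ∈-kPartsOfLength⁻ ℓ b p∈″
... | ∣p∣≡b , len≡ = trans (cong (a +ᵛ_) ∣p∣≡b) (∈-splits⁻ d ab∈) , cong suc len≡

∈-kPartsOfLength⁺ : ∀ {k} (μs : List (Vec ℕ k)) → All (_≢ 0ᵏ) μs →
  ∃ λ p → p ∈ kPartsOfLength (length μs) (Σᵛ μs) × proj₁ p ≡ μs
∈-kPartsOfLength⁺ {k} [] _ with VecP.≡-dec _≟_ (0ᵏ {k}) 0ᵏ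
... | yes _ = _ , here refl , refl
... | no  0≢0 = ⊥-elim (0≢0 refl)
∈-kPartsOfLength⁺ (a ∷ μs) (a≢0 ∷ μs≢0) with ∈-kPartsOfLength⁺ μs μs≢0
... | p , p∈ , p≡μs with cons (VecP.≡-dec _≟_ a 0ᵏ)
  where
  cons : (a≟0 : Dec (a ≡ 0ᵏ)) →
         ∃ λ q → q ∈ consNonzero a a≟0 (kPartsOfLength (length μs) (Σᵛ μs)) × proj₁ q ≡ a ∷ μs
  cons (yes a≡0) = ⊥-elim (a≢0 a≡0)
  cons (no  _)   = _ , ∈P.∈-map⁺ _ p∈ , cong (a ∷_) p≡μs
... | q , q∈ , q≡ = q , ∈-concatMap⁺ _ q∈ (∈-splits⁺ a (Σᵛ μs)) , q≡

totalDegree : ∀ {k} → Vec ℕ k → ℕ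
totalDegree {k} a = Σℕ (allFin k) (lookup a)

totalDegree-+ᵛ : ∀ {k} (a b : Vec ℕ k) → totalDegree (a +ᵛ b) ≡ totalDegree a + totalDegree b
totalDegree-+ᵛ {k} a b = trans (Σℕ-cong (allFin k) (lookup-+ᵛ a b)) (Σℕ-+ (allFin k) (lookup a) (lookup b))

totalDegree-≢0ᵏ : ∀ {k} (a : Vec ℕ k) → a ≢ 0ᵏ → 0 < totalDegree a
totalDegree-≢0ᵏ a a≢0 with ≢0ᵏ⇒∃ a a≢0
... | j , aj≢0 = ℕP.≤-trans (ℕP.n≢0⇒n>0 aj≢0) (∈⇒≤Σℕ (lookup a) (∈P.∈-allFin j))

length≤totalDegree : ∀ {k} (μs : List (Vec ℕ k)) → All (_≢ 0ᵏ) μs → length μs ≤ totalDegree (Σᵛ μs)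
length≤totalDegree []       _             = z≤n
length≤totalDegree (a ∷ μs) (a≢0 ∷ μs≢0) = subst (suc (length μs) ≤_) (sym (totalDegree-+ᵛ a _))
  (ℕP.+-mono-≤ (totalDegree-≢0ᵏ a a≢0) (length≤totalDegree μs μs≢0))

kPartsUpTo : ∀ {k} → ℕ → Vec ℕ k → List (KPart k)
kPartsUpTo zero    d = kPartsOfLength zero d
kPartsUpTo (suc ℓ) d = kPartsOfLength (suc ℓ) d ++ kPartsUpTo ℓ d

∈-kPartsUpTo⁻ : ∀ {k} ℓ (d : Vec ℕ k) {p} → p ∈ kPartsUpTo ℓ d → ∣ p ∣ ≡ d × length (proj₁ p) ≤ ℓ
∈-kPartsUpTo⁻ zero d p∈ = map₂ ℕP.≤-reflexive (∈-kPartsOfLength⁻ zero d p∈)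
∈-kPartsUpTo⁻ (suc ℓ) d p∈ with ∈P.∈-++⁻ (kPartsOfLength (suc ℓ) d) p∈
... | inj₁ p∈ℓ = map₂ ℕP.≤-reflexive (∈-kPartsOfLength⁻ (suc ℓ) d p∈ℓ)
... | inj₂ p∈< = map₂ ℕP.m≤n⇒m≤1+n (∈-kPartsUpTo⁻ ℓ d p∈<)

∈-kPartsUpTo⁺ : ∀ {k} ℓ (μs : List (Vec ℕ k)) → All (_≢ 0ᵏ) μs → length μs ≤ ℓ →
  ∃ λ p → p ∈ kPartsUpTo ℓ (Σᵛ μs) × proj₁ p ≡ μs
∈-kPartsUpTo⁺ zero μs μs≢0 len≤ with length μs | ∈-kPartsOfLength⁺ μs μs≢0
... | zero | found = found
∈-kPartsUpTo⁺ (suc ℓ) μs μs≢0 len≤ with length μs ≟ suc ℓ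
... | yes len≡ with ∈-kPartsOfLength⁺ μs μs≢0
...   | p , p∈ , p≡ = p , ∈P.∈-++⁺ˡ (subst (λ l → p ∈ kPartsOfLength l (Σᵛ μs)) len≡ p∈) , p≡
∈-kPartsUpTo⁺ (suc ℓ) μs μs≢0 len≤ | no len≢ with ∈-kPartsUpTo⁺ ℓ μs μs≢0 (s≤s⁻¹ (ℕP.≤∧≢⇒< len≤ len≢))
... | p , p∈ , p≡ = p , ∈P.∈-++⁺ʳ (kPartsOfLength (suc ℓ) (Σᵛ μs)) p∈ , p≡

AllPairs-universal : ∀ {a r} {A : Set a} {R : A → A → Set r} (xs : List A) →
  (∀ {x y} → x ∈ xs → y ∈ xs → R x y) → AllPairs R xs
AllPairs-universal []       R-all = AllPairs.[]
AllPairs-universal (x ∷ xs) R-all =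
  All.tabulate (λ y∈ → R-all (here refl) (there y∈)) AllPairs.∷ AllPairs-universal xs (λ p q → R-all (there p) (there q))

kPartsUpTo-longestFirst : ∀ {k} ℓ (d : Vec ℕ k) →
  AllPairs (λ p q → length (proj₁ q) ≤ length (proj₁ p)) (kPartsUpTo ℓ d)
kPartsUpTo-longestFirst zero d = AllPairs-universal _ λ p∈ q∈ →
  ℕP.≤-reflexive (trans (proj₂ (∈-kPartsOfLength⁻ zero d q∈)) (sym (proj₂ (∈-kPartsOfLength⁻ zero d p∈))))
kPartsUpTo-longestFirst (suc ℓ) d = AllPairsP.++⁺
  (AllPairs-universal _ λ p∈ q∈ →
    ℕP.≤-reflexive (trans (proj₂ (∈-kPartsOfLength⁻ (suc ℓ) d q∈)) (sym (proj₂ (∈-kPartsOfLength⁻ (suc ℓ) d p∈)))))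
  (kPartsUpTo-longestFirst ℓ d)
  (All.tabulate λ p∈ → All.tabulate λ q∈ →
    ℕP.≤-trans (ℕP.m≤n⇒m≤1+n (proj₂ (∈-kPartsUpTo⁻ ℓ d q∈)))
               (ℕP.≤-reflexive (sym (proj₂ (∈-kPartsOfLength⁻ (suc ℓ) d p∈)))))

AllPairs-++-∷⁻ : ∀ {a r} {A : Set a} {R : A → A → Set r} (pre : List A) {x post} →
  AllPairs R (pre ++ x ∷ post) → All (λ q → R q x) pre × All (R x) post
AllPairs-++-∷⁻ []        (Rx AllPairs.∷ _)      = [] , Rx
AllPairs-++-∷⁻ (y ∷ pre) (Ry AllPairs.∷ R-rest) =
  map₁ (All.lookup Ry (∈P.∈-++⁺ʳ pre (here refl)) ∷_) (AllPairs-++-∷⁻ pre R-rest)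

kPartsUpTo-represents : ∀ {k n} (m : Vec (Vec ℕ k) n) →
  ∃ λ μ → μ ∈ kPartsUpTo (totalDegree (multideg m)) (multideg m) × m ≋ Vec.fromList (proj₁ μ)
kPartsUpTo-represents m with ∈-kPartsUpTo⁺ (totalDegree (multideg m)) (dropZeros m) (dropZeros-≢0ᵏ m)
  (subst (λ d → length (dropZeros m) ≤ totalDegree d) (Σᵛ-dropZeros m) (length≤totalDegree _ (dropZeros-≢0ᵏ m)))
... | μ , μ∈ , μ≡ = μ , subst (λ d → μ ∈ kPartsUpTo (totalDegree (multideg m)) d) (Σᵛ-dropZeros m) μ∈
                      , subst (λ μs → m ≋ Vec.fromList μs) (sym μ≡) (≋-dropZeros m)

module Basis {c ℓ} (F : Char0Field c ℓ) (k : ℕ) where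
  module R = Char0Field F
  open R using (Carrier; _≈_; 0#; 1#; ofℕ) renaming (_+_ to _⊕_; _*_ to _⊛_; -_ to ⊝_)
  open import Relation.Binary.Reasoning.Setoid R.setoid
  open import Algebra.Properties.Group R.+-group using (x≈y⇒x∙y⁻¹≈ε; //-rightDividesˡ)

  Coefs : Set c
  Coefs = List (Carrier × KPart k)

  infix 9 _⟨_⟩

  _⟨_⟩ : Series F k → List (Vec ℕ k) → Carrier
  f ⟨ μs ⟩ = f (length μs) (Vec.fromList μs)

  term : ∀ {n} → Vec (Vec ℕ k) n → Carrier × KPart k → Carrier
  term {n} m (a , λk) = a ⊛ r F λk n m

  cancel-invertible : ∀ a y x → (a ⊛ y) ≈ 1# → (x ⊛ a) ≈ 0# → x ≈ 0#
  cancel-invertible a y x ay≈1 xa≈0 = begin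
    x                ≈⟨ R.sym (R.*-identityʳ x) ⟩
    x ⊛ 1#           ≈⟨ R.*-cong R.refl (R.sym ay≈1) ⟩
    x ⊛ (a ⊛ y)      ≈⟨ R.sym (R.*-assoc x a y) ⟩
    (x ⊛ a) ⊛ y      ≈⟨ R.*-cong xa≈0 R.refl ⟩
    0# ⊛ y           ≈⟨ R.zeroˡ y ⟩
    0#               ∎

  ofℕ-positive : ∀ {n} → 0 < n → ¬ (ofℕ n ≈ 0#)
  ofℕ-positive {suc n} _ = R.char0 n

  r-symmetric : ∀ λk → IsSymmetric F k (r F λk)
  r-symmetric λk σ n m n′ m′ m′≗m∘σ = R.reflexive (cong ofℕ (Colourings.coeffX-relabel (I λk) σ m m′ m′≗m∘σ))

  r-multidegree : ∀ λk {d} → ∣ λk ∣ ≡ d → HasMultidegree F k d (r F λk)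
  r-multidegree λk ∣λ∣≡d n m multideg≢d with Colourings.coeffX≡0⊎properProducing (I λk) m
  ... | inj₁ coeff≡0       = R.reflexive (cong ofℕ coeff≡0)
  ... | inj₂ (κ , _ , P)   = ⊥-elim (multideg≢d (trans (produces⇒multideg≡∣∣ λk m κ P) ∣λ∣≡d))

  linComb-symmetric : ∀ cs → IsSymmetric F k (linComb F cs)
  linComb-symmetric []       σ n m n′ m′ m′≗m∘σ = R.refl
  linComb-symmetric (p ∷ cs) σ n m n′ m′ m′≗m∘σ =
    R.+-cong (R.*-cong R.refl (r-symmetric (proj₂ p) σ n m n′ m′ m′≗m∘σ))
             (linComb-symmetric cs σ n m n′ m′ m′≗m∘σ)

  symmetric-≋ : ∀ {f} → IsSymmetric F k f →
    ∀ {n n′} {m : Vec (Vec ℕ k) n} {m′ : Vec (Vec ℕ k) n′} → m ≋ m′ → f n′ m′ ≈ f n m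
  symmetric-≋ f-sym (via σ ext-σ) = f-sym σ _ _ _ _ ext-σ

  r-triangular : ∀ ν μs → r F ν ⟨ μs ⟩ ≈ 0# ⊎
    (length (proj₁ ν) ≤ length μs × (length (proj₁ ν) ≡ length μs → proj₁ ν ↭ μs))
  r-triangular ν μs = ⊎-map₁ (λ coeff≡0 → R.reflexive (cong ofℕ coeff≡0)) (coeffX-I-triangular ν μs)

  r-vanishes-unless-↭ : ∀ μ νs → length νs ≤ length (proj₁ μ) → r F μ ⟨ νs ⟩ ≈ 0# ⊎ proj₁ μ ↭ νs
  r-vanishes-unless-↭ μ νs len≤ =
    ⊎-map₂ (λ (len≥ , len≡⇒↭) → len≡⇒↭ (ℕP.≤-antisym len≥ len≤)) (r-triangular μ νs)

  r-diagonal-≉0 : ∀ ν → ¬ (r F ν ⟨ proj₁ ν ⟩ ≈ 0#)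
  r-diagonal-≉0 (νs , νs≢0) = ofℕ-positive (Multipartite.coeffX-diagonal-positive νs νs≢0)

  r-diagonal⁻¹ : KPart k → Carrier
  r-diagonal⁻¹ ν = proj₁ (R.inverse _ (r-diagonal-≉0 ν))

  r-diagonal-inverse : ∀ ν → (r F ν ⟨ proj₁ ν ⟩ ⊛ r-diagonal⁻¹ ν) ≈ 1#
  r-diagonal-inverse ν = proj₂ (R.inverse _ (r-diagonal-≉0 ν))

  foldr-terms≈0 : ∀ {n} (m : Vec (Vec ℕ k) n) (cs : Coefs) z → All (λ p → term m p ≈ 0#) cs →
    List.foldr (λ p acc → term m p ⊕ acc) z cs ≈ z
  foldr-terms≈0 m []       z []              = R.refl
  foldr-terms≈0 m (p ∷ cs) z (p≈0 ∷ cs≈0) = R.trans (R.+-cong p≈0 (foldr-terms≈0 m cs z cs≈0)) (R.+-identityˡ z)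

  linComb-single : ∀ {n} (m : Vec (Vec ℕ k) n) pre p post →
    All (λ q → term m q ≈ 0#) pre → All (λ q → term m q ≈ 0#) post →
    linComb F (pre ++ p ∷ post) n m ≈ term m p
  linComb-single m pre p post pre≈0 post≈0 = begin
    List.foldr step 0# (pre ++ p ∷ post)        ≡⟨ ListP.foldr-++ step 0# pre (p ∷ post) ⟩
    List.foldr step (step p (List.foldr step 0# post)) pre  ≈⟨ foldr-terms≈0 m pre _ pre≈0 ⟩
    term m p ⊕ List.foldr step 0# post          ≈⟨ R.+-cong R.refl (foldr-terms≈0 m post 0# post≈0) ⟩
    term m p ⊕ 0#                               ≈⟨ R.+-identityʳ _ ⟩
    term m p                                    ∎
    where
    step : Carrier × KPart k → Carrier → Carrier
    step q acc = term m q ⊕ acc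

  parts : Carrier × KPart k → List (Vec ℕ k)
  parts p = proj₁ (proj₂ p)

  Distinct : Carrier × KPart k → Carrier × KPart k → Set
  Distinct p q = ¬ (parts p ↭ parts q)

  term-vanishes : ∀ q μs → ¬ (parts q ↭ μs) → (length (parts q) < length μs → proj₁ q ≈ 0#) →
    term (Vec.fromList μs) q ≈ 0#
  term-vanishes (a , ν) μs q≁μs shorter⇒a≈0 with r-triangular ν μs
  ... | inj₁ r≈0 = R.trans (R.*-cong R.refl r≈0) (R.zeroʳ a)
  ... | inj₂ (len≤ , len≡⇒↭) with length (proj₁ ν) <? length μs
  ...   | yes len< = R.trans (R.*-cong (shorter⇒a≈0 len<) R.refl) (R.zeroˡ _)
  ...   | no  len≮ = ⊥-elim (q≁μs (len≡⇒↭ (ℕP.≤-antisym len≤ (ℕP.≮⇒≥ len≮))))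

  -- evaluated at x^μ for p = (c, μ), only the term of p survives once shorter partitions are known to vanish
  isolate : ∀ pre p post → AllPairs Distinct (pre ++ p ∷ post) →
    (∀ {q} → q ∈ pre ++ p ∷ post → length (parts q) < length (parts p) → proj₁ q ≈ 0#) →
    linComb F (pre ++ p ∷ post) ⟨ parts p ⟩ ≈ 0# → proj₁ p ≈ 0#
  isolate pre p post distinct shorter≈0 lin≈0 =
    cancel-invertible (r F (proj₂ p) ⟨ parts p ⟩) (r-diagonal⁻¹ (proj₂ p)) (proj₁ p) (r-diagonal-inverse (proj₂ p))
      (R.trans (R.sym (linComb-single (Vec.fromList (parts p)) pre p post pre≈0 post≈0)) lin≈0)
    where
    others = AllPairs-++-∷⁻ pre distinct
    pre≈0 : All (λ q → term (Vec.fromList (parts p)) q ≈ 0#) pre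
    pre≈0 = All.tabulate λ {q} q∈ →
      term-vanishes q (parts p) (All.lookup (proj₁ others) q∈) (shorter≈0 (∈P.∈-++⁺ˡ q∈))
    post≈0 : All (λ q → term (Vec.fromList (parts p)) q ≈ 0#) post
    post≈0 = All.tabulate λ {q} q∈ →
      term-vanishes q (parts p) (λ q↭p → All.lookup (proj₂ others) q∈ (↭-sym q↭p))
                                (shorter≈0 (∈P.∈-++⁺ʳ pre (there q∈)))

  independent : ∀ cs → AllPairs Distinct cs → (∀ n m → linComb F cs n m ≈ 0#) → All (λ p → proj₁ p ≈ 0#) cs
  independent cs distinct lin≈0 = All.tabulate λ p∈ → All.lookup (shorterThan (Σℕ cs size)) p∈ (∈⇒≤Σℕ size p∈)
    where
    size : Carrier × KPart k → ℕ
    size p = suc (length (parts p))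
    shorterThan : ∀ L → All (λ p → length (parts p) < L → proj₁ p ≈ 0#) cs
    shorterThan zero    = All.universal (λ _ ()) cs
    shorterThan (suc L) = All.tabulate step
      where
      step : ∀ {p} → p ∈ cs → length (parts p) < suc L → proj₁ p ≈ 0#
      step {p} p∈ len<1+L with ∈P.∈-∃++ p∈
      ... | pre , post , cs≡ = isolate pre p post
        (subst (AllPairs Distinct) cs≡ distinct)
        (λ {q} q∈ len< → All.lookup (shorterThan L) (subst (q ∈_) (sym cs≡) q∈)
                           (ℕP.<-≤-trans len< (s≤s⁻¹ len<1+L)))
        (subst (λ cs → linComb F cs ⟨ parts p ⟩ ≈ 0#) cs≡ (lin≈0 (length (parts p)) (Vec.fromList (parts p))))

  linComb-multidegree : ∀ {d} cs → All (λ p → ∣ proj₂ p ∣ ≡ d) cs → HasMultidegree F k d (linComb F cs)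
  linComb-multidegree cs degs n m multideg≢d = foldr-terms≈0 m cs 0#
    (All.map (λ {p} ∣p∣≡d → R.trans (R.*-cong R.refl (r-multidegree (proj₂ p) ∣p∣≡d n m multideg≢d))
                                    (R.zeroʳ (proj₁ p))) degs)

  module Spanning (f : Series F k) (f-sym : IsSymmetric F k f) where
    Agrees : Coefs → List (Vec ℕ k) → Set ℓ
    Agrees cs μs = f ⟨ μs ⟩ ≈ linComb F cs ⟨ μs ⟩

    coefficientFor : Coefs → KPart k → Carrier
    coefficientFor cs μ = (f ⟨ proj₁ μ ⟩ ⊕ (⊝ linComb F cs ⟨ proj₁ μ ⟩)) ⊛ r-diagonal⁻¹ μ

    -- solves the triangular system, shortest partitions first
    interpolate : List (KPart k) → Coefs
    interpolate []      = []
    interpolate (μ ∷ E) = (coefficientFor (interpolate E) μ , μ) ∷ interpolate E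

    agrees-new : ∀ cs μ → Agrees ((coefficientFor cs μ , μ) ∷ cs) (proj₁ μ)
    agrees-new cs μ = R.sym (begin
      ((x ⊛ y) ⊛ a) ⊕ lin   ≈⟨ R.+-cong (R.*-assoc x y a) R.refl ⟩
      (x ⊛ (y ⊛ a)) ⊕ lin   ≈⟨ R.+-cong (R.*-cong R.refl (R.*-comm y a)) R.refl ⟩
      (x ⊛ (a ⊛ y)) ⊕ lin   ≈⟨ R.+-cong (R.*-cong R.refl (r-diagonal-inverse μ)) R.refl ⟩
      (x ⊛ 1#) ⊕ lin        ≈⟨ R.+-cong (R.*-identityʳ x) R.refl ⟩
      x ⊕ lin               ≈⟨ //-rightDividesˡ lin (f ⟨ proj₁ μ ⟩) ⟩
      f ⟨ proj₁ μ ⟩         ∎)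
      where
      lin = linComb F cs ⟨ proj₁ μ ⟩
      x = f ⟨ proj₁ μ ⟩ ⊕ (⊝ lin)
      y = r-diagonal⁻¹ μ
      a = r F μ ⟨ proj₁ μ ⟩

    -- a partition ν agreeing before stays agreeing: r_μ vanishes at x^ν, or μ ↭ ν and the new coefficient is 0
    agrees-old : ∀ cs μ νs → Agrees cs νs → length νs ≤ length (proj₁ μ) →
      Agrees ((coefficientFor cs μ , μ) ∷ cs) νs
    agrees-old cs μ νs agrees len≤ = begin
      f ⟨ νs ⟩                                                     ≈⟨ agrees ⟩
      linComb F cs ⟨ νs ⟩                                           ≈⟨ R.sym (R.+-identityˡ (linComb F cs ⟨ νs ⟩)) ⟩
      0# ⊕ linComb F cs ⟨ νs ⟩                                      ≈⟨ R.+-cong (R.sym new-term≈0) R.refl ⟩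
      (coefficientFor cs μ ⊛ r F μ ⟨ νs ⟩) ⊕ linComb F cs ⟨ νs ⟩    ∎
      where
      coefficient≈0 : proj₁ μ ↭ νs → coefficientFor cs μ ≈ 0#
      coefficient≈0 μ↭ν = R.trans (R.*-cong (x≈y⇒x∙y⁻¹≈ε {f ⟨ proj₁ μ ⟩} {linComb F cs ⟨ proj₁ μ ⟩} f≈lin) R.refl)
                                  (R.zeroˡ (r-diagonal⁻¹ μ))
        where
        f≈lin : f ⟨ proj₁ μ ⟩ ≈ linComb F cs ⟨ proj₁ μ ⟩
        f≈lin = R.trans (R.sym (symmetric-≋ f-sym (↭⇒≋ μ↭ν)))
                        (R.trans agrees (symmetric-≋ (linComb-symmetric cs) (↭⇒≋ μ↭ν)))
      new-term≈0 : (coefficientFor cs μ ⊛ r F μ ⟨ νs ⟩) ≈ 0#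
      new-term≈0 = [ (λ r≈0 → R.trans (R.*-cong R.refl r≈0) (R.zeroʳ (coefficientFor cs μ)))
                   , (λ μ↭ν → R.trans (R.*-cong (coefficient≈0 μ↭ν) R.refl) (R.zeroˡ (r F μ ⟨ νs ⟩)))
                   ]′ (r-vanishes-unless-↭ μ νs len≤)

    interpolate-agrees : ∀ E → AllPairs (λ μ ν → length (proj₁ ν) ≤ length (proj₁ μ)) E →
      All (λ μ → Agrees (interpolate E) (proj₁ μ)) E
    interpolate-agrees []      _                          = []
    interpolate-agrees (μ ∷ E) (shorter AllPairs.∷ sorted) =
      agrees-new (interpolate E) μ ∷
      All.tabulate (λ {ν} ν∈ → agrees-old (interpolate E) μ (proj₁ ν)
                                  (All.lookup (interpolate-agrees E sorted) ν∈) (All.lookup shorter ν∈))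

    interpolate-multidegree : ∀ {d} E → All (λ μ → ∣ μ ∣ ≡ d) E →
      All (λ p → ∣ proj₂ p ∣ ≡ d) (interpolate E)
    interpolate-multidegree []      []              = []
    interpolate-multidegree (μ ∷ E) (∣μ∣≡d ∷ degs) = ∣μ∣≡d ∷ interpolate-multidegree E degs

    spanning : ∀ d → HasMultidegree F k d f →
      Σ Coefs (λ cs → All (λ p → ∣ proj₂ p ∣ ≡ d) cs × (∀ n m → f n m ≈ linComb F cs n m))
    spanning d f-deg = cs , degs , agrees-everywhere
      where
      E = kPartsUpTo (totalDegree d) d
      cs = interpolate E
      degs = interpolate-multidegree E (All.tabulate λ μ∈ → proj₁ (∈-kPartsUpTo⁻ (totalDegree d) d μ∈))
      agrees-everywhere : ∀ n m → f n m ≈ linComb F cs n m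
      agrees-everywhere n m with VecP.≡-dec _≟_ (multideg m) d
      ... | no multideg≢d = R.trans (f-deg n m multideg≢d) (R.sym (linComb-multidegree cs degs n m multideg≢d))
      ... | yes multideg≡d with kPartsUpTo-represents m
      ... | μ , μ∈ , m≋μ = R.trans (R.sym (symmetric-≋ f-sym m≋μ))
        (R.trans (All.lookup (interpolate-agrees E (kPartsUpTo-longestFirst (totalDegree d) d))
                             (subst (λ e → μ ∈ kPartsUpTo (totalDegree e) e) multideg≡d μ∈))
                 (symmetric-≋ (linComb-symmetric cs) m≋μ))

lemma4p4 : ∀ {c ℓ} (F : Char0Field c ℓ) (k : ℕ) (d : Vec ℕ k) →
    (∀ (λk : KPart k) → ∣ λk ∣ ≡ d → InΛ F k d (r F λk))
    × (∀ (f : Series F k) → InΛ F k d f →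
         Σ (List (Char0Field.Carrier F × KPart k)) (λ cs →
           All (λ p → ∣ proj₂ p ∣ ≡ d) cs
           × (∀ n m → Char0Field._≈_ F (f n m) (linComb F cs n m))))
    × (∀ (cs : List (Char0Field.Carrier F × KPart k)) →
         All (λ p → ∣ proj₂ p ∣ ≡ d) cs →
         AllPairs (λ p q → ¬ (proj₁ (proj₂ p) ↭ proj₁ (proj₂ q))) cs →
         (∀ n m → Char0Field._≈_ F (linComb F cs n m) (Char0Field.0# F)) →
         All (λ p → Char0Field._≈_ F (proj₁ p) (Char0Field.0# F)) cs)
lemma4p4 F k d =
    (λ λk ∣λ∣≡d → r-symmetric λk , r-multidegree λk ∣λ∣≡d)
  , (λ f (f-sym , f-deg) → Spanning.spanning f f-sym d f-deg)
  , (λ cs _ distinct lin≈0 → independent cs distinct lin≈0)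
  where open Basis F k
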